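{- Let $G$ be a connected cellularly embedded graph, let $G_m$ be its medial graph, and for $k\ge1$ let $f_k(G_m)$ be the number of graph states of $G_m$ without crossings that have exactly $k$ components. Then \[ t\,R_G(t+1,t,1/t)=\sum_{k\ge1}f_k(G_m)\,t^k. \]
   Context: A cellularly embedded graph is a graph drawn in a closed surface with every face an open disc (equivalently a ribbon graph). Its medial graph $G_m$ is the $4$-regular embedded graph with a vertex on each edge of $G$, two vertices being joined by an edge for each face of $G$ in whose boundary the corresponding edges are consecutive. A vertex state at a vertex $v$ of $G_m$ pairs the four half-edges at $v$; a crossing pairs opposite half-edges, and the other two (non-crossing) vertex states pair adjacent half-edges. A graph state chooses a vertex state at each vertex; its components are the resulting closed curves. For $A\subseteq E(G)$, $r_G(A)=v(G)-c_G(A)$, $n_G(A)=|A|-r_G(A)$, $c_G(A)$ and $f_G(A)$ are the numbers of components and boundary components of the spanning ribbon subgraph $(V(G),A)$. The Bollob\'as--Riordan polynomial is $R_G(x,y,z)=\sum_{A\subseteq E(G)}(x-1)^{r_G(E(G))-r_G(A)}y^{n_G(A)}z^{c_G(A)-f_G(A)+n_G(A)}$. -}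

module Defs where

open import Data.Nat as ℕ using (ℕ; zero; suc; _∸_; _≤ᵇ_; _≡ᵇ_)
open import Data.Bool using (Bool; true; false; _∨_; _∧_; not; if_then_else_)
open import Data.Fin using (Fin; toℕ)
import Data.Fin as F
open import Data.Fin.Properties using (_≟_)
open import Data.List using (List; []; _∷_; map; _++_; foldr; length; filter)
open import Data.Product using (Σ)
open import Data.Bool.Properties using (T?)
open import Data.Integer using (+_)
open import Data.Rational using (ℚ; 0ℚ; 1ℚ; _+_; _*_; _-_; _/_)
open import Relation.Nullary using (¬_)
open import Relation.Nullary.Decidable using (⌊_⌋)
open import Relation.Binary.PropositionalEquality using (_≡_; _≢_)
open import Data.Sum using (_⊎_)

allFinB : (n : ℕ) → (Fin n → Bool) → Bool
allFinB zero    p = true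
allFinB (suc n) p = p F.zero ∧ allFinB n (λ i → p (F.suc i))

anyFinB : (n : ℕ) → (Fin n → Bool) → Bool
anyFinB zero    p = false
anyFinB (suc n) p = p F.zero ∨ anyFinB n (λ i → p (F.suc i))

countB : (n : ℕ) → (Fin n → Bool) → ℕ
countB zero    p = zero
countB (suc n) p = (if p F.zero then 1 else 0) ℕ.+ countB n (λ i → p (F.suc i))

allFunctions : {A : Set} → List A → (n : ℕ) → List (Fin n → A)
allFunctions vs zero    = (λ ()) ∷ []
allFunctions vs (suc n) =
  foldr (λ a acc → map (λ f → extend a f) (allFunctions vs n) ++ acc) [] vs
  where
  extend : {A : Set} → A → (Fin n → A) → Fin (suc n) → A
  extend a f F.zero    = a
  extend a f (F.suc i) = f i

allSubsets : (n : ℕ) → List (Fin n → Bool)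
allSubsets = allFunctions (false ∷ true ∷ [])

eqB : {n : ℕ} → Fin n → Fin n → Bool
eqB i j = ⌊ i ≟ j ⌋

-- reach gens k x y : y is reachable from x by at most k applications of
-- the generators (all generators used below are involutions, so the
-- reachability relation for k ≥ n is the orbit relation of the group
-- they generate).
reach : {n : ℕ} → List (Fin n → Fin n) → ℕ → Fin n → Fin n → Bool
reach gens zero    x y = eqB x y
reach {n} gens (suc k) x y =
  reach gens k x y ∨
  anyFinB n (λ z → reach gens k x z ∧ foldr (λ g b → eqB (g z) y ∨ b) false gens)

sameOrbit : {n : ℕ} → List (Fin n → Fin n) → Fin n → Fin n → Bool
sameOrbit {n} gens = reach gens n

-- number of orbits: count the orbits' least elements
numOrbits : (n : ℕ) → List (Fin n → Fin n) → ℕ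
numOrbits n gens =
  countB n (λ x → allFinB n (λ y → not (sameOrbit gens x y) ∨ (toℕ x ≤ᵇ toℕ y)))

ℕtoℚ : ℕ → ℚ
ℕtoℚ n = (+ n) / 1

_^_ : ℚ → ℕ → ℚ
q ^ zero  = 1ℚ
q ^ suc k = q * (q ^ k)

sumℚ : List ℚ → ℚ
sumℚ = foldr _+_ 0ℚ

-- Σ_{k=a}^{a+m-1} f k
sumFrom : ℕ → ℕ → (ℕ → ℚ) → ℚ
sumFrom a zero    f = 0ℚ
sumFrom a (suc m) f = f a + sumFrom (suc a) m f

data VertexState : Set where
  crossing smoothing0 smoothing2 : VertexState

isCrossing : VertexState → Bool
isCrossing crossing = true
isCrossing _        = false

-- Cellularly embedded graphs as (closed) generalized maps.
-- Flags are Fin nF.  τ0 changes the vertex (same edge, same face side),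
-- τ1 changes the edge (same vertex, same face side: the two flags of a
-- corner), τ2 changes the face side (same vertex, same edge).
-- Vertices = <τ1,τ2>-orbits, edges = <τ0,τ2>-orbits, faces = <τ0,τ1>-orbits.

record EmbeddedGraph : Set where
  field
    nF nE : ℕ
    τ0 τ1 τ2 : Fin nF → Fin nF
    τ0-inv : ∀ x → τ0 (τ0 x) ≡ x
    τ1-inv : ∀ x → τ1 (τ1 x) ≡ x
    τ2-inv : ∀ x → τ2 (τ2 x) ≡ x
    τ0-fpf : ∀ x → τ0 x ≢ x
    τ1-fpf : ∀ x → τ1 x ≢ x
    τ2-fpf : ∀ x → τ2 x ≢ x
    τ02-comm : ∀ x → τ0 (τ2 x) ≡ τ2 (τ0 x)
    τ02-fpf : ∀ x → τ0 (τ2 x) ≢ x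
    edge : Fin nF → Fin nE
    edge-τ0 : ∀ x → edge (τ0 x) ≡ edge x
    edge-τ2 : ∀ x → edge (τ2 x) ≡ edge x
    edge-orbit : ∀ x y → edge x ≡ edge y →
                 (y ≡ x) ⊎ (y ≡ τ0 x) ⊎ (y ≡ τ2 x) ⊎ (y ≡ τ0 (τ2 x))
    edge-surj : ∀ e → Σ (Fin nF) (λ x → edge x ≡ e)

open EmbeddedGraph public

module _ (G : EmbeddedGraph) where

  Connected : Set
  Connected = ∀ x y → sameOrbit (τ0 G ∷ τ1 G ∷ τ2 G ∷ []) x y ≡ true

  numVertices : ℕ
  numVertices = numOrbits (nF G) (τ1 G ∷ τ2 G ∷ [])

  EdgeSet : Set
  EdgeSet = Fin (nE G) → Bool

  card : EdgeSet → ℕ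
  card A = countB (nE G) A

  -- c_G(A): components of the spanning subgraph (V(G), A): vertices
  -- (<τ1,τ2>-orbits) are joined along the edges of A (τ0 on A-flags).
  τ0-on : EdgeSet → Fin (nF G) → Fin (nF G)
  τ0-on A x = if A (edge G x) then τ0 G x else x

  cG : EdgeSet → ℕ
  cG A = numOrbits (nF G) (τ1 G ∷ τ2 G ∷ τ0-on A ∷ [])

  -- f_G(A): boundary components of the spanning ribbon subgraph (V(G),A).
  -- Each flag marks a boundary segment; the boundary is traversed by
  -- passing a corner (τ1), running along a ribbon of an edge of A to its
  -- other end (τ0 on A-flags), or, where an edge not in A was attached,
  -- continuing along the vertex disc to the other side (τ2 on non-A flags).
  boundaryStep : EdgeSet → Fin (nF G) → Fin (nF G)
  boundaryStep A x = if A (edge G x) then τ0 G x else τ2 G x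

  fG : EdgeSet → ℕ
  fG A = numOrbits (nF G) (τ1 G ∷ boundaryStep A ∷ [])

  -- r_G(A) = v(G) - c_G(A), n_G(A) = |A| - r_G(A)
  -- (truncated subtraction; all these differences are nonnegative)
  rG : EdgeSet → ℕ
  rG A = numVertices ∸ cG A

  nG : EdgeSet → ℕ
  nG A = card A ∸ rG A

  fullSet : EdgeSet
  fullSet _ = true

  -- The Bollobás–Riordan polynomial evaluated at x y z ∈ ℚ
  -- R_G = Σ_A (x-1)^{r(E)-r(A)} y^{n(A)} z^{c(A)-f(A)+n(A)}
  BR : ℚ → ℚ → ℚ → ℚ
  BR x y z = sumℚ (map term (allSubsets (nE G)))
    where
    term : EdgeSet → ℚ
    term A = ((x - 1ℚ) ^ (rG fullSet ∸ rG A)) * (y ^ nG A)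
             * (z ^ ((cG A ℕ.+ nG A) ∸ fG A))

  -- The medial graph G_m: one vertex per edge e of G; its half-edges are
  -- the flags of G (the half-edge x lies at the medial vertex edge x and
  -- points into the corner {x, τ1 x}); the medial edges are the corners,
  -- i.e. the τ1-pairs {x, τ1 x} (two edges consecutive in a face boundary).
  -- Around the medial vertex of the edge containing the flag a the four
  -- half-edges occur in the cyclic order a, τ0 a, τ0 τ2 a, τ2 a.
  -- A vertex state is a pairing of these four half-edges:
  --   crossing   : opposite half-edges  (a ↔ τ0τ2 a, τ0 a ↔ τ2 a)
  --   smoothing0 : adjacent half-edges  (a ↔ τ0 a,   τ2 a ↔ τ0τ2 a)
  --   smoothing2 : adjacent half-edges  (a ↔ τ2 a,   τ0 a ↔ τ0τ2 a)

  GraphState : Set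
  GraphState = Fin (nE G) → VertexState

  statePairing : GraphState → Fin (nF G) → Fin (nF G)
  statePairing s x with s (edge G x)
  ... | crossing   = τ0 G (τ2 G x)
  ... | smoothing0 = τ0 G x
  ... | smoothing2 = τ2 G x

  -- components (closed curves) of a graph state: alternately follow a
  -- medial edge (τ1) and the pairing at a medial vertex
  stateComponents : GraphState → ℕ
  stateComponents s = numOrbits (nF G) (τ1 G ∷ statePairing s ∷ [])

  noCrossings : GraphState → Bool
  noCrossings s = allFinB (nE G) (λ e → not (isCrossing (s e)))

  allGraphStates : List GraphState
  allGraphStates = allFunctions (crossing ∷ smoothing0 ∷ smoothing2 ∷ []) (nE G)

  fk : ℕ → ℕ
  fk k = length (filter (λ s → T? (noCrossings s ∧ (stateComponents s ≡ᵇ k))) allGraphStates)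

module Submission where

-- Both sides equal Σ_A t^{f(A)}, A ranging over edge sets.  Right side: a
-- non-crossing state of G_m is an edge set A (follow the ribbon of e when
-- e ∈ A, cut across it otherwise) and its curves are the boundary components
-- of (V(G), A).  Left side: as r(E) = v - 1, t times the A-th term of R_G is
-- t^{f(A)}, provided the truncated exponents are honest, i.e. the Euler
-- inequalities  c ≤ v,  v ≤ c + |A|,  v + f ≤ |A| + 2c  hold.  These are proved
-- by adding edges one at a time: an edge inside a component keeps c and raises
-- f by at most one; an edge joining two components lowers c and f by one (a
-- parity argument on its four flags).

open import Defs
open import Data.Nat as ℕ using (ℕ; zero; suc; _≤_; _<_; z≤n; s≤s; _∸_)
import Data.Nat.Properties as ℕₚ
open import Data.Bool using (Bool; true; false; _∨_; _∧_; not; if_then_else_; T)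
open import Data.Bool.Properties using (T?)
open import Data.Fin as Fin using (Fin; toℕ)
open import Data.Product using (∃; _×_; _,_; proj₁; proj₂)
open import Data.Sum using (_⊎_; inj₁; inj₂)
open import Data.Empty using (⊥-elim)
open import Data.Unit using (tt)
open import Relation.Nullary using (¬_; Dec; yes; no)
open import Relation.Nullary.Decidable using (toWitness; fromWitness)
open import Relation.Binary.PropositionalEquality
open import Function using (id; _∘_)

module BoolFacts where

  ∧-intro : ∀ {a b} → T a → T b → T (a ∧ b)
  ∧-intro {true} _ q = q

  ∧-fst : ∀ {a b} → T (a ∧ b) → T a
  ∧-fst {true} _ = tt

  ∧-snd : ∀ {a b} → T (a ∧ b) → T b
  ∧-snd {true} q = q

  ∨-inl : ∀ {a b} → T a → T (a ∨ b)
  ∨-inl {true} _ = tt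

  ∨-inr : ∀ {a b} → T b → T (a ∨ b)
  ∨-inr {true}  _ = tt
  ∨-inr {false} q = q

  ∨-elim : ∀ {a b} → T (a ∨ b) → T a ⊎ T b
  ∨-elim {true}  _ = inj₁ tt
  ∨-elim {false} q = inj₂ q

  not-intro : ∀ {a} → ¬ T a → T (not a)
  not-intro {true}  p = p tt
  not-intro {false} _ = tt

  not-elim : ∀ {a} → T (not a) → ¬ T a
  not-elim {true} ()

  T-ext : ∀ {a b} → (T a → T b) → (T b → T a) → a ≡ b
  T-ext {true}  {true}  _ _ = refl
  T-ext {true}  {false} f _ = ⊥-elim (f tt)
  T-ext {false} {true}  _ g = ⊥-elim (g tt)
  T-ext {false} {false} _ _ = refl

  T⇒≡true : ∀ {a} → T a → a ≡ true
  T⇒≡true {true} _ = refl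

  ≡true⇒T : ∀ {a} → a ≡ true → T a
  ≡true⇒T refl = tt

  ¬T⇒≡false : ∀ {a} → ¬ T a → a ≡ false
  ¬T⇒≡false {true}  p = ⊥-elim (p tt)
  ¬T⇒≡false {false} _ = refl

  ∨-false : ∀ {a b} → ¬ T b → a ∨ b ≡ a
  ∨-false {true}  _ = refl
  ∨-false {false} nb = ¬T⇒≡false nb

  ≡⇒eqB : ∀ {n} {i j : Fin n} → i ≡ j → T (eqB i j)
  ≡⇒eqB = fromWitness

  eqB-refl : ∀ {n} (i : Fin n) → T (eqB i i)
  eqB-refl i = ≡⇒eqB refl

  eqB⇒≡ : ∀ {n} {i j : Fin n} → T (eqB i j) → i ≡ j
  eqB⇒≡ = toWitness

  ≢⇒¬eqB : ∀ {n} {i j : Fin n} → i ≢ j → ¬ T (eqB i j)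
  ≢⇒¬eqB i≢j h = i≢j (eqB⇒≡ h)

module FiniteCounting where
  open BoolFacts
  open import Data.Nat using (_+_)
  open import Data.Nat.Divisibility using (_∣_; _∣0; ∣-refl; ∣m∣n⇒∣m+n)
  open import Data.Fin.Properties using (suc-injective; all?; any?; ¬∀⟶∃¬)

  allFinB-intro : ∀ n {p : Fin n → Bool} → (∀ i → T (p i)) → T (allFinB n p)
  allFinB-intro zero    _ = tt
  allFinB-intro (suc n) f = ∧-intro (f Fin.zero) (allFinB-intro n (λ i → f (Fin.suc i)))

  allFinB-elim : ∀ n {p : Fin n → Bool} → T (allFinB n p) → ∀ i → T (p i)
  allFinB-elim (suc n)     h Fin.zero    = ∧-fst h
  allFinB-elim (suc n) {p} h (Fin.suc i) = allFinB-elim n (∧-snd {p Fin.zero} h) i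

  anyFinB-intro : ∀ n {p : Fin n → Bool} i → T (p i) → T (anyFinB n p)
  anyFinB-intro (suc n)     Fin.zero    h = ∨-inl h
  anyFinB-intro (suc n) {p} (Fin.suc i) h = ∨-inr {p Fin.zero} (anyFinB-intro n i h)

  anyFinB-elim : ∀ n {p : Fin n → Bool} → T (anyFinB n p) → ∃ λ i → T (p i)
  anyFinB-elim (suc n) {p} h with ∨-elim {p Fin.zero} h
  ... | inj₁ q = Fin.zero , q
  ... | inj₂ q with anyFinB-elim n q
  ...   | i , r = Fin.suc i , r

  allFinB-cong : ∀ n {p q : Fin n → Bool} → (∀ i → p i ≡ q i) → allFinB n p ≡ allFinB n q
  allFinB-cong n p≗q = T-ext
    (λ h → allFinB-intro n (λ i → subst T (p≗q i) (allFinB-elim n h i)))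
    (λ h → allFinB-intro n (λ i → subst T (sym (p≗q i)) (allFinB-elim n h i)))

  anyFinB-cong : ∀ n {p q : Fin n → Bool} → (∀ i → p i ≡ q i) → anyFinB n p ≡ anyFinB n q
  anyFinB-cong n p≗q = T-ext
    (λ h → let (i , r) = anyFinB-elim n h in anyFinB-intro n i (subst T (p≗q i) r))
    (λ h → let (i , r) = anyFinB-elim n h in anyFinB-intro n i (subst T (sym (p≗q i)) r))

  allOrCounterexample : ∀ n (p : Fin n → Bool) → (∀ i → T (p i)) ⊎ ∃ λ i → ¬ T (p i)
  allOrCounterexample n p with all? (λ i → T? (p i))
  ... | yes all = inj₁ all
  ... | no ¬all = inj₂ (¬∀⟶∃¬ n (λ i → T (p i)) (λ i → T? (p i)) ¬all)

  indicator : Bool → ℕ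
  indicator b = if b then 1 else 0

  indicator-mono : ∀ {a b} → (T a → T b) → indicator a ≤ indicator b
  indicator-mono {true}  {true}  _ = s≤s z≤n
  indicator-mono {true}  {false} f = ⊥-elim (f tt)
  indicator-mono {false}         _ = z≤n

  countB-cong : ∀ n {p q : Fin n → Bool} → (∀ i → p i ≡ q i) → countB n p ≡ countB n q
  countB-cong zero    _   = refl
  countB-cong (suc n) p≗q =
    cong₂ (λ a b → indicator a + b) (p≗q Fin.zero) (countB-cong n (λ i → p≗q (Fin.suc i)))

  countB-≤ : ∀ n (p : Fin n → Bool) → countB n p ≤ n
  countB-≤ zero    _ = z≤n
  countB-≤ (suc n) p with p Fin.zero
  ... | true  = s≤s (countB-≤ n _)
  ... | false = ℕₚ.m≤n⇒m≤1+n (countB-≤ n _)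

  countB-mono : ∀ n {p q : Fin n → Bool} → (∀ i → T (p i) → T (q i)) → countB n p ≤ countB n q
  countB-mono zero    _   = z≤n
  countB-mono (suc n) p⊆q =
    ℕₚ.+-mono-≤ (indicator-mono (p⊆q Fin.zero)) (countB-mono n (λ i → p⊆q (Fin.suc i)))

  countB-strict : ∀ n {p q : Fin n → Bool} → (∀ i → T (p i) → T (q i)) →
    (j : Fin n) → ¬ T (p j) → T (q j) → suc (countB n p) ≤ countB n q
  countB-strict (suc n) {p} {q} p⊆q Fin.zero ¬pj qj with p Fin.zero | q Fin.zero
  ... | true  | _     = ⊥-elim (¬pj tt)
  ... | false | true  = s≤s (countB-mono n (λ i → p⊆q (Fin.suc i)))
  ... | false | false = ⊥-elim qj
  countB-strict (suc n) {p} p⊆q (Fin.suc j) ¬pj qj =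
    ℕₚ.≤-trans (ℕₚ.≤-reflexive (sym (ℕₚ.+-suc (indicator (p Fin.zero)) _)))
      (ℕₚ.+-mono-≤ (indicator-mono (p⊆q Fin.zero)) (countB-strict n (λ i → p⊆q (Fin.suc i)) j ¬pj qj))

  countB-drop : ∀ n {p q : Fin n → Bool} (m : Fin n) → T (p m) → ¬ T (q m) →
    (∀ i → i ≢ m → p i ≡ q i) → countB n p ≡ suc (countB n q)
  countB-drop (suc n) {p} {q} Fin.zero pm ¬qm agree with p Fin.zero | q Fin.zero
  ... | false | _     = ⊥-elim pm
  ... | true  | true  = ⊥-elim (¬qm tt)
  ... | true  | false = cong suc (countB-cong n (λ i → agree (Fin.suc i) (λ ())))
  countB-drop (suc n) {p} {q} (Fin.suc m) pm ¬qm agree =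
    trans (cong₂ _+_ (cong indicator (agree Fin.zero (λ ())))
                     (countB-drop n m pm ¬qm (λ i i≢m → agree (Fin.suc i) (i≢m ∘ suc-injective))))
          (ℕₚ.+-suc (indicator (q Fin.zero)) _)

  countB-none : ∀ n {p : Fin n → Bool} → (∀ i → ¬ T (p i)) → countB n p ≡ 0
  countB-none zero    _ = refl
  countB-none (suc n) {p} none with p Fin.zero | none Fin.zero
  ... | true  | h = ⊥-elim (h tt)
  ... | false | _ = countB-none n (λ i → none (Fin.suc i))

  countB-remove : ∀ n (p : Fin n → Bool) (m : Fin n) → T (p m) →
    countB n p ≡ suc (countB n (λ i → p i ∧ not (eqB i m)))
  countB-remove n p m pm = countB-drop n m pm
    (λ h → not-elim (∧-snd {p m} h) (eqB-refl m))
    (λ i i≢m → sym (T-ext ∧-fst (λ pi → ∧-intro pi (not-intro (≢⇒¬eqB i≢m)))))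

  countB-pos : ∀ n {p : Fin n → Bool} (i : Fin n) → T (p i) → 1 ≤ countB n p
  countB-pos n {p} i pi rewrite countB-remove n p i pi = s≤s z≤n

  countB-single : ∀ n (m : Fin n) → countB n (λ i → eqB i m) ≡ 1
  countB-single n m =
    trans (countB-drop n {q = λ _ → false} m (eqB-refl m) (λ ()) (λ i i≢m → ¬T⇒≡false (≢⇒¬eqB i≢m)))
          (cong suc (countB-none n (λ _ ())))

  countB-split : ∀ n (p q : Fin n → Bool) →
    countB n p ≡ countB n (λ i → p i ∧ q i) + countB n (λ i → p i ∧ not (q i))
  countB-split zero    _ _ = refl
  countB-split (suc n) p q =
    trans (cong₂ _+_ (indicator-split (p Fin.zero) (q Fin.zero))
                     (countB-split n (λ i → p (Fin.suc i)) (λ i → q (Fin.suc i))))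
          (interchange (indicator (p Fin.zero ∧ q Fin.zero)) (indicator (p Fin.zero ∧ not (q Fin.zero))) _ _)
    where
    indicator-split : ∀ a b → indicator a ≡ indicator (a ∧ b) + indicator (a ∧ not b)
    indicator-split true  true  = refl
    indicator-split true  false = refl
    indicator-split false _     = refl
    interchange : ∀ a b c d → (a + b) + (c + d) ≡ (a + c) + (b + d)
    interchange a b c d = solve 4 (λ a b c d → (a :+ b) :+ (c :+ d) := (a :+ c) :+ (b :+ d)) refl a b c d
      where open import Data.Nat.Solver using (module +-*-Solver)
            open +-*-Solver

  -- A predicate closed under a fixed-point-free involution σ holds at an even
  -- number of points: its points split into σ-orbits {x, σ x} of size two.
  countB-even : ∀ n (σ : Fin n → Fin n) → (∀ i → σ (σ i) ≡ i) → (∀ i → σ i ≢ i) →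
    (P : Fin n → Bool) → (∀ i → T (P i) → T (P (σ i))) → 2 ∣ countB n P
  countB-even n σ σ-inv σ-fpf P P-closed = go (countB n P) P refl P-closed
    where
    go : ∀ k (P : Fin n → Bool) → countB n P ≡ k → (∀ i → T (P i) → T (P (σ i))) → 2 ∣ k
    go k P #P closed with any? (λ i → T? (P i))
    ... | no nothing = subst (2 ∣_) (trans (sym (countB-none n (λ i Pi → nothing (i , Pi)))) #P) (2 ∣0)
    ... | yes (x , Px) = peel k (trans (sym #P) #P≡)
      where
      P₁ P₂ : Fin n → Bool
      P₁ i = P i ∧ not (eqB i x)
      P₂ i = P₁ i ∧ not (eqB i (σ x))
      P₁σx : T (P₁ (σ x))
      P₁σx = ∧-intro (closed x Px) (not-intro (≢⇒¬eqB (σ-fpf x)))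
      #P≡ : countB n P ≡ 2 + countB n P₂
      #P≡ = trans (countB-remove n P x Px) (cong suc (countB-remove n P₁ (σ x) P₁σx))
      closed₂ : ∀ i → T (P₂ i) → T (P₂ (σ i))
      closed₂ i h = ∧-intro (∧-intro (closed i (∧-fst (∧-fst h))) (not-intro σi≢x)) (not-intro σi≢σx)
        where
        i≢x : i ≢ x
        i≢x i≡x = not-elim (∧-snd {P i} (∧-fst h)) (≡⇒eqB i≡x)
        i≢σx : i ≢ σ x
        i≢σx i≡σx = not-elim (∧-snd {P₁ i} h) (≡⇒eqB i≡σx)
        σi≢x : ¬ T (eqB (σ i) x)
        σi≢x h' = i≢σx (trans (sym (σ-inv i)) (cong σ (eqB⇒≡ h')))
        σi≢σx : ¬ T (eqB (σ i) (σ x))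
        σi≢σx h' = i≢x (trans (sym (σ-inv i)) (trans (cong σ (eqB⇒≡ h')) (σ-inv x)))
      peel : ∀ k → k ≡ 2 + countB n P₂ → 2 ∣ k
      peel (suc (suc k)) eq = ∣m∣n⇒∣m+n ∣-refl (go k P₂ (ℕₚ.suc-injective (ℕₚ.suc-injective (sym eq))) closed₂)

-- Every
-- subset arises from ∅ by inserting its elements in increasing order, which
-- yields an induction principle for properties invariant under pointwise
-- equality; it drives the proof of the Euler inequalities.
module SubsetInduction {m : ℕ} where
  open BoolFacts
  open FiniteCounting
  open import Data.Nat using (_<?_)
  open import Relation.Nullary.Decidable using (⌊_⌋)
  open import Data.Fin.Properties using (toℕ<n; toℕ-fromℕ<; toℕ-injective)

  Subset : Set
  Subset = Fin m → Bool

  _≐_ : Subset → Subset → Set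
  A ≐ B = ∀ i → A i ≡ B i

  ∅ : Subset
  ∅ _ = false

  insert : Subset → Fin m → Subset
  insert A e i = A i ∨ eqB i e

  countB-insert : ∀ A e → ¬ T (A e) → countB m (insert A e) ≡ suc (countB m A)
  countB-insert A e e∉A =
    countB-drop m e (∨-inr {A e} (eqB-refl e)) e∉A (λ i i≢e → ∨-false (≢⇒¬eqB i≢e))

  prefix : Subset → ℕ → Subset
  prefix A k i = A i ∧ ⌊ toℕ i <? k ⌋

  prefix-intro : ∀ {A k i} → T (A i) → toℕ i < k → T (prefix A k i)
  prefix-intro Ai i<k = ∧-intro Ai (fromWitness i<k)

  prefix-elim : ∀ {A k i} → T (prefix A k i) → T (A i) × toℕ i < k
  prefix-elim {A} {k} {i} h = ∧-fst h , toWitness (∧-snd {A i} h)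

  prefix-zero : ∀ A → ∅ ≐ prefix A 0
  prefix-zero A i = T-ext (λ ()) (λ h → ⊥-elim (ℕₚ.n≮0 (proj₂ (prefix-elim {A} h))))

  prefix-all : ∀ A → prefix A m ≐ A
  prefix-all A i = T-ext (λ h → proj₁ (prefix-elim {A} h)) (λ Ai → prefix-intro {A} Ai (toℕ<n i))

  prefix-grow : ∀ {A k i} → T (prefix A k i) → T (prefix A (suc k) i)
  prefix-grow {A} h = let (Ai , i<k) = prefix-elim {A} h in prefix-intro {A} Ai (ℕₚ.m≤n⇒m≤1+n i<k)

  prefix-suc-elim : ∀ {A k i} → T (prefix A (suc k) i) → T (prefix A k i) ⊎ toℕ i ≡ k
  prefix-suc-elim {A} h with prefix-elim {A} h
  ... | Ai , i<1+k with ℕₚ.m≤n⇒m<n∨m≡n (ℕₚ.≤-pred i<1+k)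
  ...   | inj₁ i<k = inj₁ (prefix-intro {A} Ai i<k)
  ...   | inj₂ i≡k = inj₂ i≡k

  prefix-skip : ∀ A k → (∀ i → toℕ i ≡ k → ¬ T (A i)) → prefix A k ≐ prefix A (suc k)
  prefix-skip A k skip i = T-ext (prefix-grow {A}) back
    where
    back : T (prefix A (suc k) i) → T (prefix A k i)
    back h with prefix-suc-elim {A} h
    ... | inj₁ q   = q
    ... | inj₂ i≡k = ⊥-elim (skip i i≡k (proj₁ (prefix-elim {A} h)))

  prefix-insert : ∀ A k e → toℕ e ≡ k → T (A e) → insert (prefix A k) e ≐ prefix A (suc k)
  prefix-insert A k e e≡k Ae i = T-ext to from
    where
    to : T (insert (prefix A k) e i) → T (prefix A (suc k) i)
    to h with ∨-elim {prefix A k i} h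
    ... | inj₁ q = prefix-grow {A} q
    ... | inj₂ q with eqB⇒≡ q
    ...   | refl = prefix-intro {A} Ae (ℕₚ.≤-reflexive (cong suc e≡k))
    from : T (prefix A (suc k) i) → T (insert (prefix A k) e i)
    from h with prefix-suc-elim {A} h
    ... | inj₁ q   = ∨-inl q
    ... | inj₂ i≡k = ∨-inr {prefix A k i} (≡⇒eqB (toℕ-injective (trans i≡k (sym e≡k))))

  subset-induction : (P : Subset → Set) → (∀ {A B} → A ≐ B → P A → P B) → P ∅ →
    (∀ A e → ¬ T (A e) → P A → P (insert A e)) → ∀ A → P A
  subset-induction P resp P∅ P-insert A = resp (prefix-all A) (upTo m)
    where
    upTo : ∀ k → P (prefix A k)
    upTo zero = resp (prefix-zero A) P∅
    upTo (suc k) with k <? m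
    ... | no k≮m = resp (prefix-skip A k (λ i i≡k _ → k≮m (subst (_< m) i≡k (toℕ<n i)))) (upTo k)
    ... | yes k<m with T? (A (Fin.fromℕ< k<m))
    ...   | yes Ae = resp (prefix-insert A k e (toℕ-fromℕ< k<m) Ae) (P-insert (prefix A k) e notYet (upTo k))
      where
      e = Fin.fromℕ< k<m
      notYet : ¬ T (prefix A k e)
      notYet h = ℕₚ.<-irrefl (toℕ-fromℕ< k<m) (proj₂ (prefix-elim {A} h))
    ...   | no ¬Ae = resp (prefix-skip A k skip) (upTo k)
      where
      skip : ∀ i → toℕ i ≡ k → ¬ T (A i)
      skip i i≡k Ai = ¬Ae (subst (λ j → T (A j)) (toℕ-injective (trans i≡k (sym (toℕ-fromℕ< k<m)))) Ai)

-- Reachability stabilises by step n, so sameOrbit is the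
-- reflexive-transitive closure of the generators: the least reflexive
-- transitive relation containing every  z ↦ g z, and an equivalence relation
-- when all generators are involutions.
module Orbits {n : ℕ} where
  open BoolFacts
  open FiniteCounting
  open import Data.Nat using (_+_)
  open import Data.List using (List; []; _∷_; foldr)
  open import Data.List.Relation.Unary.Any using (here; there)
  open import Data.List.Relation.Unary.All using (All; []; _∷_)
  open import Data.List.Membership.Propositional using (_∈_)

  Maps : Set
  Maps = List (Fin n → Fin n)

  oneStep : Maps → Fin n → Fin n → Bool
  oneStep gens z y = foldr (λ g b → eqB (g z) y ∨ b) false gens

  oneStep-intro : ∀ {gens : Maps} {g} → g ∈ gens → ∀ z → T (oneStep gens z (g z))
  oneStep-intro {g ∷ _}        (here refl) z = ∨-inl (eqB-refl (g z))
  oneStep-intro {g′ ∷ _} {g}   (there g∈)  z = ∨-inr {eqB (g′ z) (g z)} (oneStep-intro g∈ z)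

  oneStep-elim : ∀ (gens : Maps) {z y} → T (oneStep gens z y) → ∃ λ g → g ∈ gens × g z ≡ y
  oneStep-elim (g ∷ gens) {z} {y} h with ∨-elim {eqB (g z) y} h
  ... | inj₁ q = g , here refl , eqB⇒≡ q
  ... | inj₂ q with oneStep-elim gens q
  ...   | g′ , g′∈ , eq = g′ , there g′∈ , eq

  reach-weaken : ∀ (gens : Maps) {k k′} → k ≤ k′ → ∀ {x y} → T (reach gens k x y) → T (reach gens k′ x y)
  reach-weaken gens {k} {k′} k≤k′ {x} {y} h =
    subst (λ m → T (reach gens m x y)) (ℕₚ.m∸n+n≡m k≤k′) (go (k′ ∸ k))
    where
    go : ∀ d → T (reach gens (d + k) x y)
    go zero    = h
    go (suc d) = ∨-inl (go d)

  reach-extend : ∀ (gens : Maps) k {x z y} → T (reach gens k x z) → T (oneStep gens z y) → T (reach gens (suc k) x y)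
  reach-extend gens k {x} {z} {y} h s =
    ∨-inr {reach gens k x y} (anyFinB-intro n {λ w → reach gens k x w ∧ oneStep gens w y} z (∧-intro h s))

  reach-induction : ∀ (gens : Maps) {x} (Q : Fin n → Set) → Q x → (∀ {z y} → Q z → T (oneStep gens z y) → Q y) →
    ∀ k {y} → T (reach gens k x y) → Q y
  reach-induction gens Q qx closed zero    h = subst Q (eqB⇒≡ h) qx
  reach-induction gens {x} Q qx closed (suc k) {y} h with ∨-elim {reach gens k x y} h
  ... | inj₁ r = reach-induction gens Q qx closed k r
  ... | inj₂ r with anyFinB-elim n r
  ...   | z , w = closed (reach-induction gens Q qx closed k (∧-fst w)) (∧-snd {reach gens k x z} w)

  Stable : Maps → Fin n → ℕ → Set
  Stable gens x j = ∀ y → reach gens (suc j) x y ≡ reach gens j x y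

  stable-suc : ∀ (gens : Maps) x j → Stable gens x j → Stable gens x (suc j)
  stable-suc gens x j st y =
    cong₂ _∨_ (st y) (anyFinB-cong n (λ z → cong (_∧ oneStep gens z y) (st z)))

  stable-+ : ∀ (gens : Maps) x j → Stable gens x j → ∀ d y → reach gens (d + j) x y ≡ reach gens j x y
  stable-+ gens x j st zero    y = refl
  stable-+ gens x j st (suc d) y = trans (stable d y) (stable-+ gens x j st d y)
    where
    stable : ∀ d → Stable gens x (d + j)
    stable zero    = st
    stable (suc d) = stable-suc gens x (d + j) (stable d)

  -- before stabilising, each step adds a point, so after k steps either the
  -- set is stable or it has more than k points
  stable-or-large : ∀ (gens : Maps) x k → (∃ λ j → j ≤ k × Stable gens x j) ⊎ (suc k ≤ countB n (reach gens k x))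
  stable-or-large gens x zero = inj₂ (countB-pos n x (eqB-refl x))
  stable-or-large gens x (suc k) with stable-or-large gens x k
  ... | inj₁ (j , j≤k , st) = inj₁ (j , ℕₚ.m≤n⇒m≤1+n j≤k , st)
  ... | inj₂ large with allOrCounterexample n (λ y → not (reach gens (suc k) x y) ∨ reach gens k x y)
  ...   | inj₁ noNew = inj₁ (k , ℕₚ.n≤1+n k , λ y → T-ext (shrink y) ∨-inl)
    where
    shrink : ∀ y → T (reach gens (suc k) x y) → T (reach gens k x y)
    shrink y h with ∨-elim {not (reach gens (suc k) x y)} (noNew y)
    ... | inj₁ q = ⊥-elim (not-elim q h)
    ... | inj₂ q = q
  ...   | inj₂ (y , new) = inj₂ (ℕₚ.≤-trans (s≤s large)
          (countB-strict n (λ _ → ∨-inl) y (λ h → new (∨-inr {not (reach gens (suc k) x y)} h)) (newReached new)))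
    where
    newReached : ∀ {a b} → ¬ T (not a ∨ b) → T a
    newReached {true}  _ = tt
    newReached {false} h = h tt

  -- a set of more than n points of Fin n is impossible, so by step n the
  -- reachable set is stable
  stable-at-n : ∀ (gens : Maps) x y → reach gens (suc n) x y ≡ reach gens n x y
  stable-at-n gens x y with stable-or-large gens x n
  ... | inj₂ large = ⊥-elim (ℕₚ.<-irrefl refl (ℕₚ.≤-trans large (countB-≤ n _)))
  ... | inj₁ (j , j≤n , st) = trans (atStable (ℕₚ.m≤n⇒m≤1+n j≤n)) (sym (atStable j≤n))
    where
    atStable : ∀ {m} → j ≤ m → reach gens m x y ≡ reach gens j x y
    atStable {m} j≤m = subst (λ m → reach gens m x y ≡ reach gens j x y) (ℕₚ.m∸n+n≡m j≤m)
                             (stable-+ gens x j st (m ∸ j) y)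

  sameOrbit-step : ∀ (gens : Maps) {x z y} → T (sameOrbit gens x z) → T (oneStep gens z y) → T (sameOrbit gens x y)
  sameOrbit-step gens {x} {z} {y} h s = subst T (stable-at-n gens x y) (reach-extend gens n h s)

  sameOrbit-refl : ∀ (gens : Maps) x → T (sameOrbit gens x x)
  sameOrbit-refl gens x = reach-weaken gens {0} {n} z≤n (eqB-refl x)

  sameOrbit-trans : ∀ (gens : Maps) {x z y} → T (sameOrbit gens x z) → T (sameOrbit gens z y) → T (sameOrbit gens x y)
  sameOrbit-trans gens {x} {z} h₁ h₂ =
    reach-induction gens {z} (λ w → T (sameOrbit gens x w)) h₁ (sameOrbit-step gens) n h₂

  sameOrbit-gen : ∀ {gens : Maps} {g} → g ∈ gens → ∀ z → T (sameOrbit gens z (g z))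
  sameOrbit-gen {gens} g∈ z =
    reach-weaken gens {1} {n} (nonEmpty z) (reach-extend gens 0 (eqB-refl z) (oneStep-intro g∈ z))
    where
    nonEmpty : Fin n → 1 ≤ n
    nonEmpty Fin.zero    = s≤s z≤n
    nonEmpty (Fin.suc _) = s≤s z≤n

  sameOrbit-gen≡ : ∀ {gens : Maps} {g z w} → g ∈ gens → g z ≡ w → T (sameOrbit gens z w)
  sameOrbit-gen≡ g∈ refl = sameOrbit-gen g∈ _

  sameOrbit-least : ∀ (gens : Maps) (Q : Fin n → Fin n → Bool) →
    (∀ x → T (Q x x)) → (∀ {x y z} → T (Q x y) → T (Q y z) → T (Q x z)) →
    (∀ {g} → g ∈ gens → ∀ z → T (Q z (g z))) →
    ∀ {x y} → T (sameOrbit gens x y) → T (Q x y)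
  sameOrbit-least gens Q Q-refl Q-trans Q-gens {x} =
    reach-induction gens {x} (λ w → T (Q x w)) (Q-refl x) closed n
    where
    closed : ∀ {z y} → T (Q x z) → T (oneStep gens z y) → T (Q x y)
    closed {z} h s with oneStep-elim gens s
    ... | g , g∈ , refl = Q-trans h (Q-gens g∈ z)

  sameOrbit-⊆ : ∀ (gens gens′ : Maps) → (∀ {g} → g ∈ gens → ∀ z → T (sameOrbit gens′ z (g z))) →
    ∀ {x y} → T (sameOrbit gens x y) → T (sameOrbit gens′ x y)
  sameOrbit-⊆ gens gens′ = sameOrbit-least gens (sameOrbit gens′) (sameOrbit-refl gens′) (sameOrbit-trans gens′)

  Involutions : Maps → Set
  Involutions = All (λ g → ∀ z → g (g z) ≡ z)

  sameOrbit-sym : ∀ (gens : Maps) → Involutions gens → ∀ {x y} → T (sameOrbit gens x y) → T (sameOrbit gens y x)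
  sameOrbit-sym gens invs {x} = reach-induction gens {x} (λ w → T (sameOrbit gens w x)) (sameOrbit-refl gens x) back n
    where
    involutive : ∀ {g} → g ∈ gens → ∀ z → g (g z) ≡ z
    involutive = lookup′ invs
      where
      lookup′ : ∀ {gs} → Involutions gs → ∀ {g} → g ∈ gs → ∀ z → g (g z) ≡ z
      lookup′ (p ∷ _)  (here refl) = p
      lookup′ (_ ∷ ps) (there g∈)  = lookup′ ps g∈
    back : ∀ {z y} → T (sameOrbit gens z x) → T (oneStep gens z y) → T (sameOrbit gens y x)
    back {z} h s with oneStep-elim gens s
    ... | g , g∈ , refl = sameOrbit-trans gens (sameOrbit-gen≡ g∈ (involutive g∈ z)) h

  record Equivalence (R : Fin n → Fin n → Bool) : Set where
    field
      refl′ : ∀ x → T (R x x)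
      sym′  : ∀ {x y} → T (R x y) → T (R y x)
      trans′ : ∀ {x y z} → T (R x y) → T (R y z) → T (R x z)

  sameOrbit-equivalence : ∀ (gens : Maps) → Involutions gens → Equivalence (sameOrbit gens)
  sameOrbit-equivalence gens invs = record
    { refl′ = sameOrbit-refl gens ; sym′ = sameOrbit-sym gens invs ; trans′ = sameOrbit-trans gens }

  data Pointwise : Maps → Maps → Set where
    []  : Pointwise [] []
    _∷_ : ∀ {g g′ gs gs′} → (∀ z → g z ≡ g′ z) → Pointwise gs gs′ → Pointwise (g ∷ gs) (g′ ∷ gs′)

  sameOrbit-pointwise : ∀ {gs gs′ : Maps} → Pointwise gs gs′ → ∀ x y → sameOrbit gs x y ≡ sameOrbit gs′ x y
  sameOrbit-pointwise {gs} {gs′} pw = reach-cong n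
    where
    oneStep-cong : ∀ {gs gs′ : Maps} → Pointwise gs gs′ → ∀ z y → oneStep gs z y ≡ oneStep gs′ z y
    oneStep-cong []         z y = refl
    oneStep-cong (g≗ ∷ pw) z y = cong₂ _∨_ (cong (λ w → eqB w y) (g≗ z)) (oneStep-cong pw z y)
    reach-cong : ∀ k x y → reach gs k x y ≡ reach gs′ k x y
    reach-cong zero    x y = refl
    reach-cong (suc k) x y = cong₂ _∨_ (reach-cong k x y)
      (anyFinB-cong n (λ z → cong₂ _∧_ (reach-cong k x z) (oneStep-cong pw z y)))

-- A class
-- is counted through its least element, exactly as 'numOrbits' does, so that
-- numOrbits n gens = classCount (sameOrbit gens).
module ClassCounting {n : ℕ} where
  open BoolFacts
  open FiniteCounting
  open Orbits {n}
  open import Data.Nat using (_≤ᵇ_)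
  open import Data.Fin.Properties using (toℕ-injective)
  open import Relation.Binary.Definitions using (tri<; tri≈; tri>)

  Rel : Set
  Rel = Fin n → Fin n → Bool

  IsLeast : Rel → Fin n → Bool
  IsLeast R x = allFinB n (λ y → not (R x y) ∨ (toℕ x ≤ᵇ toℕ y))

  classCount : Rel → ℕ
  classCount R = countB n (IsLeast R)

  isLeast-elim : ∀ {R x y} → T (IsLeast R x) → T (R x y) → toℕ x ≤ toℕ y
  isLeast-elim {R} {x} {y} h r with ∨-elim {not (R x y)} (allFinB-elim n h y)
  ... | inj₁ q = ⊥-elim (not-elim q r)
  ... | inj₂ q = ℕₚ.≤ᵇ⇒≤ (toℕ x) (toℕ y) q

  isLeast-intro : ∀ {R x} → (∀ y → T (R x y) → toℕ x ≤ toℕ y) → T (IsLeast R x)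
  isLeast-intro {R} {x} below = allFinB-intro n λ y → test y (T? (R x y))
    where
    test : ∀ y → Dec (T (R x y)) → T (not (R x y) ∨ (toℕ x ≤ᵇ toℕ y))
    test y (yes r) = ∨-inr {not (R x y)} (ℕₚ.≤⇒≤ᵇ (below y r))
    test y (no ¬r) = ∨-inl (not-intro ¬r)

  isLeast-unique : ∀ {R} → Equivalence R → ∀ {r r′} → T (IsLeast R r) → T (IsLeast R r′) →
    T (R r r′) → r ≡ r′
  isLeast-unique {R} eq h h′ rr′ =
    toℕ-injective (ℕₚ.≤-antisym (isLeast-elim {R} h rr′) (isLeast-elim {R} h′ (Equivalence.sym′ eq rr′)))

  -- every class has a least element (descend while a smaller equivalent point exists)
  isLeast-exists : ∀ {R} → Equivalence R → ∀ x → ∃ λ r → T (R x r) × T (IsLeast R r)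
  isLeast-exists {R} eq x = descend (suc (toℕ x)) x ℕₚ.≤-refl
    where
    open Equivalence eq
    descend : ∀ fuel y → toℕ y < fuel → ∃ λ r → T (R y r) × T (IsLeast R r)
    descend (suc fuel) y y<fuel with T? (IsLeast R y)
    ... | yes least = y , refl′ y , least
    ... | no ¬least with allOrCounterexample n (λ z → not (R y z) ∨ (toℕ y ≤ᵇ toℕ z))
    ...   | inj₁ all = ⊥-elim (¬least (allFinB-intro n all))
    ...   | inj₂ (z , smaller) with descend fuel z (ℕₚ.≤-trans z<y (ℕₚ.≤-pred y<fuel))
      where
      z<y : toℕ z < toℕ y
      z<y = ℕₚ.≰⇒> (λ y≤z → smaller (∨-inr {not (R y z)} (ℕₚ.≤⇒≤ᵇ y≤z)))
    ...     | r , zr , least = r , trans′ Ryz zr , least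
      where
      Ryz : T (R y z)
      Ryz with T? (R y z)
      ... | yes q = q
      ... | no ¬q = ⊥-elim (smaller (∨-inl (not-intro ¬q)))

  classCount-cong : ∀ {R R′} → (∀ x y → R x y ≡ R′ x y) → classCount R ≡ classCount R′
  classCount-cong R≗R′ = countB-cong n (λ x → allFinB-cong n (λ y → cong (λ b → not b ∨ _) (R≗R′ x y)))

  classCount-ext : ∀ {R R′} → (∀ {x y} → T (R x y) → T (R′ x y)) → (∀ {x y} → T (R′ x y) → T (R x y)) →
    classCount R ≡ classCount R′
  classCount-ext to from = classCount-cong (λ x y → T-ext to from)

  classCount-pos : ∀ {R} → Equivalence R → Fin n → 1 ≤ classCount R
  classCount-pos eq x with isLeast-exists eq x
  ... | r , _ , least = countB-pos n r least

  classCount-total : ∀ {R} → Equivalence R → (∀ x y → T (R x y)) → Fin n → classCount R ≡ 1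
  classCount-total {R} eq total x with isLeast-exists eq x
  ... | r , _ , least = trans (countB-cong n onlyR) (countB-single n r)
    where
    onlyR : ∀ y → IsLeast R y ≡ eqB y r
    onlyR y = T-ext (λ least′ → ≡⇒eqB (isLeast-unique eq least′ least (total y r)))
                    (λ y≡r → subst (λ w → T (IsLeast R w)) (sym (eqB⇒≡ y≡r)) least)

  merge : Rel → Fin n → Fin n → Rel
  merge R a b x y = R x y ∨ (R x a ∧ R b y) ∨ (R x b ∧ R a y)

  data MergeView (R : Rel) (a b x y : Fin n) : Set where
    direct  : T (R x y) → MergeView R a b x y
    via-a-b : T (R x a) → T (R b y) → MergeView R a b x y
    via-b-a : T (R x b) → T (R a y) → MergeView R a b x y

  mergeView : ∀ R a b {x y} → T (merge R a b x y) → MergeView R a b x y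
  mergeView R a b {x} {y} h with ∨-elim {R x y} h
  ... | inj₁ q = direct q
  ... | inj₂ q with ∨-elim {R x a ∧ R b y} q
  ...   | inj₁ r = via-a-b (∧-fst r) (∧-snd {R x a} r)
  ...   | inj₂ r = via-b-a (∧-fst r) (∧-snd {R x b} r)

  merge-direct : ∀ R a b {x y} → T (R x y) → T (merge R a b x y)
  merge-direct R a b h = ∨-inl h

  merge-via-a-b : ∀ R a b {x y} → T (R x a) → T (R b y) → T (merge R a b x y)
  merge-via-a-b R a b {x} {y} xa by = ∨-inr {R x y} (∨-inl (∧-intro xa by))

  merge-via-b-a : ∀ R a b {x y} → T (R x b) → T (R a y) → T (merge R a b x y)
  merge-via-b-a R a b {x} {y} xb ay = ∨-inr {R x y} (∨-inr {R x a ∧ R b y} (∧-intro xb ay))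

  merge-equivalence : ∀ {R} → Equivalence R → ∀ a b → Equivalence (merge R a b)
  merge-equivalence {R} eq a b = record { refl′ = λ x → ∨-inl (refl′ x) ; sym′ = symm ; trans′ = transit }
    where
    open Equivalence eq
    symm : ∀ {x y} → T (merge R a b x y) → T (merge R a b y x)
    symm h with mergeView R a b h
    ... | direct p      = merge-direct R a b (sym′ p)
    ... | via-a-b xa by = merge-via-b-a R a b (sym′ by) (sym′ xa)
    ... | via-b-a xb ay = merge-via-a-b R a b (sym′ ay) (sym′ xb)
    transit : ∀ {x y z} → T (merge R a b x y) → T (merge R a b y z) → T (merge R a b x z)
    transit h k with mergeView R a b h | mergeView R a b k
    ... | direct p      | direct q      = merge-direct R a b (trans′ p q)
    ... | direct p      | via-a-b ya bz = merge-via-a-b R a b (trans′ p ya) bz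
    ... | direct p      | via-b-a yb az = merge-via-b-a R a b (trans′ p yb) az
    ... | via-a-b xa by | direct q      = merge-via-a-b R a b xa (trans′ by q)
    ... | via-a-b xa _  | via-a-b _ bz  = merge-via-a-b R a b xa bz
    ... | via-a-b xa by | via-b-a yb az = merge-direct R a b (trans′ xa az)
    ... | via-b-a xb ay | direct q      = merge-via-b-a R a b xb (trans′ ay q)
    ... | via-b-a xb ay | via-a-b ya bz = merge-direct R a b (trans′ xb bz)
    ... | via-b-a xb _  | via-b-a _ az  = merge-via-b-a R a b xb az

  merge-fused : ∀ {R} → Equivalence R → ∀ a b → T (merge R a b a b)
  merge-fused {R} eq a b = merge-via-a-b R a b (Equivalence.refl′ eq a) (Equivalence.refl′ eq b)

  merge-fused′ : ∀ {R} → Equivalence R → ∀ a b → T (merge R a b b a)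
  merge-fused′ {R} eq a b = merge-via-b-a R a b (Equivalence.refl′ eq b) (Equivalence.refl′ eq a)

  merge-least : ∀ {R Q} → Equivalence Q → (∀ {x y} → T (R x y) → T (Q x y)) → ∀ {a b} → T (Q a b) →
    ∀ {x y} → T (merge R a b x y) → T (Q x y)
  merge-least {R} eq R⊆Q {a} {b} ab h with mergeView R a b h
  ... | direct p      = R⊆Q p
  ... | via-a-b xa by = trans′ (R⊆Q xa) (trans′ ab (R⊆Q by))
    where open Equivalence eq
  ... | via-b-a xb ay = trans′ (R⊆Q xb) (trans′ (sym′ ab) (R⊆Q ay))
    where open Equivalence eq

  merge-related : ∀ {R} → Equivalence R → ∀ {a b} → T (R a b) → ∀ x y → merge R a b x y ≡ R x y
  merge-related {R} eq {a} {b} ab x y = T-ext (merge-least eq (λ p → p) ab) (merge-direct R a b)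

  merge-comm : ∀ R a b x y → merge R a b x y ≡ merge R b a x y
  merge-comm R a b x y = T-ext (swap a b) (swap b a)
    where
    swap : ∀ a b → T (merge R a b x y) → T (merge R b a x y)
    swap a b h with mergeView R a b h
    ... | direct p      = merge-direct R b a p
    ... | via-a-b xa by = merge-via-b-a R b a xa by
    ... | via-b-a xb ay = merge-via-a-b R b a xb ay

  classCount-merge-related : ∀ {R} → Equivalence R → ∀ {a b} → T (R a b) → classCount (merge R a b) ≡ classCount R
  classCount-merge-related eq ab = classCount-cong (merge-related eq ab)

  -- if the least element of a's class precedes that of b's, merging loses
  -- exactly b's least element
  private
    classCount-merge-ordered : ∀ {R} → Equivalence R → ∀ {a b ra rb} → T (R a ra) → T (IsLeast R ra) →
      T (R b rb) → T (IsLeast R rb) → toℕ ra < toℕ rb → classCount R ≡ suc (classCount (merge R a b))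
    classCount-merge-ordered {R} eq {a} {b} {ra} {rb} a~ra ra-least b~rb rb-least ra<rb =
      countB-drop n rb rb-least rb-not-least sameLeast
      where
      open Equivalence eq
      M = merge R a b
      rb-not-least : ¬ T (IsLeast M rb)
      rb-not-least h = ℕₚ.<⇒≱ ra<rb (isLeast-elim {M} h (merge-via-b-a R a b (sym′ b~rb) a~ra))
      sameLeast : ∀ i → i ≢ rb → IsLeast R i ≡ IsLeast M i
      sameLeast i i≢rb = T-ext to (λ h → isLeast-intro {R} (λ y r → isLeast-elim {M} h (merge-direct R a b r)))
        where
        to : T (IsLeast R i) → T (IsLeast M i)
        to least = isLeast-intro {M} below
          where
          below : ∀ y → T (M i y) → toℕ i ≤ toℕ y
          below y h with mergeView R a b h
          ... | direct p = isLeast-elim {R} least p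
          ... | via-a-b ia by with isLeast-unique eq least ra-least (trans′ ia a~ra)
          ...   | refl = ℕₚ.≤-trans (ℕₚ.<⇒≤ ra<rb) (isLeast-elim {R} rb-least (trans′ (sym′ b~rb) by))
          below y h | via-b-a ib _ = ⊥-elim (i≢rb (isLeast-unique eq least rb-least (trans′ ib b~rb)))

  classCount-merge-unrelated : ∀ {R} → Equivalence R → ∀ {a b} → ¬ T (R a b) →
    classCount R ≡ suc (classCount (merge R a b))
  classCount-merge-unrelated {R} eq {a} {b} ¬ab with isLeast-exists eq a | isLeast-exists eq b
  ... | ra , a~ra , ra-least | rb , b~rb , rb-least with ℕₚ.<-cmp (toℕ ra) (toℕ rb)
  ...   | tri< ra<rb _ _ = classCount-merge-ordered eq a~ra ra-least b~rb rb-least ra<rb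
  ...   | tri≈ _ ra≡rb _ = ⊥-elim (¬ab (trans′ a~ra (subst (λ w → T (R w b)) (toℕ-injective (sym ra≡rb)) (sym′ b~rb))))
    where open Equivalence eq
  ...   | tri> _ _ rb<ra = trans (classCount-merge-ordered eq b~rb rb-least a~ra ra-least rb<ra)
                                 (cong suc (classCount-cong (merge-comm R b a)))

  classCount-merge-≥ : ∀ {R} → Equivalence R → ∀ a b → classCount R ≤ suc (classCount (merge R a b))
  classCount-merge-≥ {R} eq a b with T? (R a b)
  ... | yes ab  = ℕₚ.≤-trans (ℕₚ.≤-reflexive (sym (classCount-merge-related eq ab))) (ℕₚ.n≤1+n _)
  ... | no ¬ab = ℕₚ.≤-reflexive (classCount-merge-unrelated eq ¬ab)

  -- a coarser equivalence has fewer classes: least elements stay least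
  classCount-antitone : ∀ {R R′} → (∀ {x y} → T (R x y) → T (R′ x y)) → classCount R′ ≤ classCount R
  classCount-antitone {R} {R′} R⊆R′ =
    countB-mono n (λ x least → isLeast-intro {R} (λ y r → isLeast-elim {R′} least (R⊆R′ r)))

  -- Fusing a with b and then c with d leaves at most one class more than
  -- fusing a with c and then b with d: fusing a with c in the first relation
  -- already makes it coarser than the second.
  classCount-reorder-≤ : ∀ {E} → Equivalence E → ∀ a b c d →
    classCount (merge (merge E a b) c d) ≤ suc (classCount (merge (merge E a c) b d))
  classCount-reorder-≤ {E} eq a b c d =
    ℕₚ.≤-trans (classCount-merge-≥ K₁-equivalence a c) (s≤s (classCount-antitone K₂⊆Q))
    where
    K₁ = merge (merge E a b) c d
    K₁-equivalence = merge-equivalence (merge-equivalence eq a b) c d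
    Q = merge K₁ a c
    open Equivalence (merge-equivalence K₁-equivalence a c)
    lift : ∀ {x y} → T (K₁ x y) → T (Q x y)
    lift = merge-direct K₁ a c
    E⊆Q : ∀ {x y} → T (E x y) → T (Q x y)
    E⊆Q h = lift (merge-direct (merge E a b) c d (merge-direct E a b h))
    a~c : T (Q a c)
    a~c = merge-fused K₁-equivalence a c
    b~d : T (Q b d)
    b~d = trans′ (lift (merge-direct (merge E a b) c d (merge-fused′ eq a b)))
                 (trans′ a~c (lift (merge-fused (merge-equivalence eq a b) c d)))
    K₂⊆Q : ∀ {x y} → T (merge (merge E a c) b d x y) → T (Q x y)
    K₂⊆Q = merge-least (merge-equivalence K₁-equivalence a c)
             (merge-least (merge-equivalence K₁-equivalence a c) E⊆Q a~c) b~d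

  classCount-reorder-≡ : ∀ {E} → Equivalence E → ∀ {a b c d} → T (E a c) → T (E b d) → ¬ T (E a b) →
    classCount (merge (merge E a c) b d) ≡ suc (classCount (merge (merge E a b) c d))
  classCount-reorder-≡ {E} eq {a} {b} {c} {d} ac bd ¬ab = begin
    classCount (merge (merge E a c) b d) ≡⟨ classCount-merge-related (merge-equivalence eq a c) (merge-direct E a c bd) ⟩
    classCount (merge E a c)             ≡⟨ classCount-merge-related eq ac ⟩
    classCount E                         ≡⟨ classCount-merge-unrelated eq ¬ab ⟩
    suc (classCount (merge E a b))       ≡⟨ cong suc (sym (classCount-merge-related (merge-equivalence eq a b)
                                              (merge-via-a-b E a b (Equivalence.sym′ eq ac) bd))) ⟩
    suc (classCount (merge (merge E a b) c d)) ∎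
    where open ≡-Reasoning

module EulerArithmetic where
  open import Data.Nat using (_+_)

  record EulerBounds (v c m f : ℕ) : Set where
    field
      components≤vertices       : c ≤ v
      vertices≤components+edges : v ≤ c + m
      genus-nonnegative         : v + f ≤ m + (c + c)

  bounds-within : ∀ {v c m f f′} → EulerBounds v c m f → f′ ≤ suc f → EulerBounds v c (suc m) f′
  bounds-within {v} {c} {m} {f} bounds f′≤1+f = record
    { components≤vertices       = components≤vertices
    ; vertices≤components+edges = ℕₚ.≤-trans vertices≤components+edges (ℕₚ.+-monoʳ-≤ c (ℕₚ.n≤1+n m))
    ; genus-nonnegative         = ℕₚ.≤-trans (ℕₚ.+-monoʳ-≤ v f′≤1+f)
                                    (ℕₚ.≤-trans (ℕₚ.≤-reflexive (ℕₚ.+-suc v f)) (s≤s genus-nonnegative))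
    }
    where open EulerBounds bounds

  bounds-joining : ∀ {v c m f} → EulerBounds v (suc c) m (suc f) → EulerBounds v c (suc m) f
  bounds-joining {v} {c} {m} {f} bounds = record
    { components≤vertices       = ℕₚ.≤-trans (ℕₚ.n≤1+n c) components≤vertices
    ; vertices≤components+edges = subst (v ≤_) (sym (ℕₚ.+-suc c m)) vertices≤components+edges
    ; genus-nonnegative         = ℕₚ.≤-pred (subst₂ _≤_ (ℕₚ.+-suc v f) (rearrange m c) genus-nonnegative)
    }
    where
    open EulerBounds bounds
    open import Data.Nat.Solver using (module +-*-Solver)
    open +-*-Solver
    rearrange : ∀ m c → m + (suc c + suc c) ≡ suc (suc m + (c + c))
    rearrange = solve 2 (λ m c → m :+ ((con 1 :+ c) :+ (con 1 :+ c)) := con 1 :+ ((con 1 :+ m) :+ (c :+ c))) refl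

open EulerArithmetic using (EulerBounds; module EulerBounds)

module RibbonSubgraphs (G : EmbeddedGraph) where
  open BoolFacts
  open FiniteCounting
  open SubsetInduction {nE G}
  open Orbits {nF G}
  open ClassCounting {nF G}
  open import Data.Nat using (_+_)
  open import Data.List using ([]; _∷_)
  open import Data.List.Relation.Unary.All using ([]; _∷_)
  open import Data.List.Relation.Unary.Any using (here; there)
  open import Data.List.Membership.Propositional using (_∈_)

  Flag : Set
  Flag = Fin (nF G)

  Involutive : (Flag → Flag) → Set
  Involutive f = ∀ z → f (f z) ≡ z

  EdgePreserving : (Flag → Flag) → Set
  EdgePreserving f = ∀ z → edge G (f z) ≡ edge G z

  -- act by f on the flags of edges in A and by g on the others; τ0-on and
  -- boundaryStep of Defs are of this form
  edgewise : EdgeSet G → (Flag → Flag) → (Flag → Flag) → Flag → Flag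
  edgewise A f g z = if A (edge G z) then f z else g z

  edgewise-in : ∀ A f g {z} → T (A (edge G z)) → edgewise A f g z ≡ f z
  edgewise-in A f g {z} h with A (edge G z)
  ... | true = refl

  edgewise-out : ∀ A f g {z} → ¬ T (A (edge G z)) → edgewise A f g z ≡ g z
  edgewise-out A f g {z} h with A (edge G z)
  ... | true  = ⊥-elim (h tt)
  ... | false = refl

  edgewise-edge : ∀ A {f g} → EdgePreserving f → EdgePreserving g → EdgePreserving (edgewise A f g)
  edgewise-edge A {f} {g} f-edge g-edge z with A (edge G z)
  ... | true  = f-edge z
  ... | false = g-edge z

  edgewise-involutive : ∀ A {f g} → EdgePreserving f → EdgePreserving g → Involutive f → Involutive g →
    Involutive (edgewise A f g)
  edgewise-involutive A {f} {g} f-edge g-edge f-inv g-inv z with T? (A (edge G z))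
  ... | yes in-A = begin
    edgewise A f g (edgewise A f g z) ≡⟨ cong (edgewise A f g) (edgewise-in A f g in-A) ⟩
    edgewise A f g (f z)              ≡⟨ edgewise-in A f g (subst (λ i → T (A i)) (sym (f-edge z)) in-A) ⟩
    f (f z)                           ≡⟨ f-inv z ⟩
    z                                 ∎
    where open ≡-Reasoning
  ... | no ¬in-A = begin
    edgewise A f g (edgewise A f g z) ≡⟨ cong (edgewise A f g) (edgewise-out A f g ¬in-A) ⟩
    edgewise A f g (g z)              ≡⟨ edgewise-out A f g (¬in-A ∘ subst (λ i → T (A i)) (g-edge z)) ⟩
    g (g z)                           ≡⟨ g-inv z ⟩
    z                                 ∎
    where open ≡-Reasoning

  edgewise-fpf : ∀ A {f g} → (∀ z → f z ≢ z) → (∀ z → g z ≢ z) → ∀ z → edgewise A f g z ≢ z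
  edgewise-fpf A {f} {g} f-fpf g-fpf z with A (edge G z)
  ... | true  = f-fpf z
  ... | false = g-fpf z

  τ0-edge : EdgePreserving (τ0 G)
  τ0-edge = edge-τ0 G

  τ2-edge : EdgePreserving (τ2 G)
  τ2-edge = edge-τ2 G

  id-edge : EdgePreserving (λ z → z)
  id-edge _ = refl

  boundaryStep-edge : ∀ A → EdgePreserving (boundaryStep G A)
  boundaryStep-edge A = edgewise-edge A τ0-edge τ2-edge

  boundaryStep-involutive : ∀ A → Involutive (boundaryStep G A)
  boundaryStep-involutive A = edgewise-involutive A τ0-edge τ2-edge (τ0-inv G) (τ2-inv G)

  τ0-on-involutive : ∀ A → Involutive (τ0-on G A)
  τ0-on-involutive A = edgewise-involutive A τ0-edge id-edge (τ0-inv G) (λ _ → refl)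

  vertexRel : Rel
  vertexRel = sameOrbit (τ1 G ∷ τ2 G ∷ [])

  componentGens : EdgeSet G → Maps
  componentGens A = τ1 G ∷ τ2 G ∷ τ0-on G A ∷ []

  componentRel : EdgeSet G → Rel
  componentRel A = sameOrbit (componentGens A)

  boundaryGens : EdgeSet G → Maps
  boundaryGens A = τ1 G ∷ boundaryStep G A ∷ []

  boundaryRel : EdgeSet G → Rel
  boundaryRel A = sameOrbit (boundaryGens A)

  componentRel-equivalence : ∀ A → Equivalence (componentRel A)
  componentRel-equivalence A = sameOrbit-equivalence (componentGens A) (τ1-inv G ∷ τ2-inv G ∷ τ0-on-involutive A ∷ [])

  boundaryRel-equivalence : ∀ A → Equivalence (boundaryRel A)
  boundaryRel-equivalence A = sameOrbit-equivalence (boundaryGens A) (τ1-inv G ∷ boundaryStep-involutive A ∷ [])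

  boundaryStep-component : ∀ A z → T (componentRel A z (boundaryStep G A z))
  boundaryStep-component A z with T? (A (edge G z))
  ... | yes in-A = sameOrbit-gen≡ (there (there (here refl)))
                     (trans (edgewise-in A (τ0 G) (λ z → z) in-A) (sym (edgewise-in A (τ0 G) (τ2 G) in-A)))
  ... | no ¬in-A = sameOrbit-gen≡ (there (here refl)) (sym (edgewise-out A (τ0 G) (τ2 G) ¬in-A))

  v : ℕ
  v = numVertices G

  cG-cong : ∀ {A B} → A ≐ B → cG G A ≡ cG G B
  cG-cong A≐B = classCount-cong (sameOrbit-pointwise
    ((λ _ → refl) ∷ (λ _ → refl) ∷ (λ z → cong (λ b → if b then τ0 G z else z) (A≐B (edge G z))) ∷ []))

  fG-cong : ∀ {A B} → A ≐ B → fG G A ≡ fG G B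
  fG-cong A≐B = classCount-cong (sameOrbit-pointwise
    ((λ _ → refl) ∷ (λ z → cong (λ b → if b then τ0 G z else τ2 G z) (A≐B (edge G z))) ∷ []))

  cG-∅ : cG G ∅ ≡ v
  cG-∅ = classCount-ext (sameOrbit-⊆ (componentGens ∅) _ to) (sameOrbit-⊆ _ (componentGens ∅) from)
    where
    to : ∀ {g} → g ∈ componentGens ∅ → ∀ z → T (vertexRel z (g z))
    to (here refl)                 = sameOrbit-gen (here refl)
    to (there (here refl))         = sameOrbit-gen (there (here refl))
    to (there (there (here refl))) = sameOrbit-refl _
    from : ∀ {g} → g ∈ (τ1 G ∷ τ2 G ∷ []) → ∀ z → T (componentRel ∅ z (g z))
    from (here refl)         = sameOrbit-gen (here refl)
    from (there (here refl)) = sameOrbit-gen (there (here refl))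

  fG-∅ : fG G ∅ ≡ v
  fG-∅ = classCount-cong (sameOrbit-pointwise ((λ _ → refl) ∷ (λ _ → refl) ∷ []))

  cG-full : Connected G → Flag → cG G (fullSet G) ≡ 1
  cG-full connected z = classCount-total (componentRel-equivalence (fullSet G))
    (λ x y → sameOrbit-⊆ (τ0 G ∷ τ1 G ∷ τ2 G ∷ []) (componentGens (fullSet G)) gens (≡true⇒T (connected x y))) z
    where
    gens : ∀ {g} → g ∈ (τ0 G ∷ τ1 G ∷ τ2 G ∷ []) → ∀ z → T (componentRel (fullSet G) z (g z))
    gens (here refl)                 = sameOrbit-gen (there (there (here refl)))
    gens (there (here refl))         = sameOrbit-gen (here refl)
    gens (there (there (here refl))) = sameOrbit-gen (there (here refl))

  -- The four flags
  -- of e are a, b = τ0 a, c = τ2 a and d = τ0 c; the boundary of (V(G), A)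
  -- crosses e as a ↔ c, b ↔ d, that of (V(G), A ∪ {e}) runs along it as
  -- a ↔ b, c ↔ d.
  module AddEdge (A : EdgeSet G) (e : Fin (nE G)) (e∉A : ¬ T (A e)) (a : Flag) (a∈e : edge G a ≡ e) where
    open import Data.Fin.Properties using (_≟_)
    open import Data.Nat.Divisibility using (_∣_; ∣m+n∣m⇒∣n; ∣1⇒≡1)

    A′ : EdgeSet G
    A′ = insert A e

    b c d : Flag
    b = τ0 G a
    c = τ2 G a
    d = τ0 G c

    -- (a function rather than a 'with' on _≟_, which would rewrite eqB in goals)
    on-or-off-e : ∀ z → edge G z ≡ e ⊎ edge G z ≢ e
    on-or-off-e z with edge G z ≟ e
    ... | yes z∈e = inj₁ z∈e
    ... | no z∉e  = inj₂ z∉e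

    flags-of-e : ∀ y → edge G y ≡ e → y ≡ a ⊎ y ≡ b ⊎ y ≡ c ⊎ y ≡ d
    flags-of-e y y∈e = edge-orbit G a y (trans a∈e (sym y∈e))

    -- the same four flags, listed as the pairs crossing e
    flags-of-e′ : ∀ y → edge G y ≡ e → y ≡ a ⊎ y ≡ c ⊎ y ≡ b ⊎ y ≡ d
    flags-of-e′ y y∈e with flags-of-e y y∈e
    ... | inj₁ p                = inj₁ p
    ... | inj₂ (inj₁ p)         = inj₂ (inj₂ (inj₁ p))
    ... | inj₂ (inj₂ (inj₁ p))  = inj₂ (inj₁ p)
    ... | inj₂ (inj₂ (inj₂ p))  = inj₂ (inj₂ (inj₂ p))

    flags-of-e″ : ∀ y → edge G y ≡ e → y ≡ b ⊎ y ≡ d ⊎ y ≡ a ⊎ y ≡ c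
    flags-of-e″ y y∈e with flags-of-e y y∈e
    ... | inj₁ p                = inj₂ (inj₂ (inj₁ p))
    ... | inj₂ (inj₁ p)         = inj₁ p
    ... | inj₂ (inj₂ (inj₁ p))  = inj₂ (inj₂ (inj₂ p))
    ... | inj₂ (inj₂ (inj₂ p))  = inj₂ (inj₁ p)

    b∈e : edge G b ≡ e
    b∈e = trans (τ0-edge a) a∈e

    c∈e : edge G c ≡ e
    c∈e = trans (τ2-edge a) a∈e

    τ2b≡d : τ2 G b ≡ d
    τ2b≡d = sym (τ02-comm G a)

    in-A′ : ∀ {y} → edge G y ≡ e → T (A′ (edge G y))
    in-A′ {y} y∈e = ∨-inr {A (edge G y)} (≡⇒eqB y∈e)

    not-in-A : ∀ {y} → edge G y ≡ e → ¬ T (A (edge G y))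
    not-in-A y∈e h = e∉A (subst (λ i → T (A i)) y∈e h)

    A′-off-e : ∀ {y} → edge G y ≢ e → A′ (edge G y) ≡ A (edge G y)
    A′-off-e y∉e = ∨-false (≢⇒¬eqB y∉e)

    card-insert : card G A′ ≡ suc (card G A)
    card-insert = countB-insert A e e∉A

    a~c : T (componentRel A a c)
    a~c = sameOrbit-gen (there (here refl)) a

    b~d : T (componentRel A b d)
    b~d = sameOrbit-gen≡ (there (here refl)) τ2b≡d

    -- components: adding e fuses the components of its ends a and b
    merged : Rel
    merged = merge (componentRel A) a b

    componentRel-grows : ∀ {y z} → T (componentRel A y z) → T (componentRel A′ y z)
    componentRel-grows = sameOrbit-⊆ (componentGens A) (componentGens A′) gens
      where
      gens : ∀ {g} → g ∈ componentGens A → ∀ z → T (componentRel A′ z (g z))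
      gens (here refl)                   = sameOrbit-gen (here refl)
      gens (there (here refl))           = sameOrbit-gen (there (here refl))
      gens (there (there (here refl))) z with T? (A (edge G z))
      ... | yes in-A = sameOrbit-gen≡ (there (there (here refl)))
                         (trans (edgewise-in A′ (τ0 G) id (∨-inl in-A)) (sym (edgewise-in A (τ0 G) id in-A)))
      ... | no ¬in-A = subst (T ∘ componentRel A′ z) (sym (edgewise-out A (τ0 G) id ¬in-A))
                         (sameOrbit-refl _ z)

    componentRel-A′⊆merged : ∀ {y z} → T (componentRel A′ y z) → T (merged y z)
    componentRel-A′⊆merged = sameOrbit-least (componentGens A′) merged refl′ trans′ gens
      where
      open Equivalence (merge-equivalence (componentRel-equivalence A) a b)
      open Equivalence (componentRel-equivalence A) using () renaming (sym′ to s)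
      along-e : ∀ z → z ≡ a ⊎ z ≡ b ⊎ z ≡ c ⊎ z ≡ d → T (merged z (τ0 G z))
      along-e z (inj₁ refl)                = merge-fused (componentRel-equivalence A) a b
      along-e z (inj₂ (inj₁ refl))         = subst (T ∘ merged b) (sym (τ0-inv G a)) (merge-fused′ (componentRel-equivalence A) a b)
      along-e z (inj₂ (inj₂ (inj₁ refl)))  = merge-via-a-b (componentRel A) a b (s a~c) b~d
      along-e z (inj₂ (inj₂ (inj₂ refl)))  = subst (T ∘ merged d) (sym (τ0-inv G c)) (merge-via-b-a (componentRel A) a b (s b~d) a~c)
      gens : ∀ {g} → g ∈ componentGens A′ → ∀ z → T (merged z (g z))
      gens (here refl)                   z = merge-direct (componentRel A) a b (sameOrbit-gen (here refl) z)
      gens (there (here refl))           z = merge-direct (componentRel A) a b (sameOrbit-gen (there (here refl)) z)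
      gens (there (there (here refl)))   z with on-or-off-e z
      ... | inj₁ z∈e = subst (T ∘ merged z) (sym (edgewise-in A′ (τ0 G) id (in-A′ z∈e)))
                        (along-e z (flags-of-e z z∈e))
      ... | inj₂ z∉e = merge-direct (componentRel A) a b (sameOrbit-gen≡ (there (there (here refl)))
                        (cong (λ β → if β then τ0 G z else z) (sym (A′-off-e z∉e))))

    cG-insert : cG G A′ ≡ classCount merged
    cG-insert = classCount-ext componentRel-A′⊆merged
      (merge-least (componentRel-equivalence A′) componentRel-grows
        (sameOrbit-gen≡ (there (there (here refl))) (edgewise-in A′ (τ0 G) id (in-A′ a∈e))))

    -- boundaries: the boundary walk of A with e cut out, stopping at its flags
    cut : Flag → Flag
    cut = edgewise (λ i → eqB i e) id (boundaryStep G A)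

    cutRel : Rel
    cutRel = sameOrbit (τ1 G ∷ cut ∷ [])

    cutRel-equivalence : Equivalence cutRel
    cutRel-equivalence = sameOrbit-equivalence _ (τ1-inv G ∷ cut-involutive ∷ [])
      where
      cut-involutive : Involutive cut
      cut-involutive = edgewise-involutive (λ i → eqB i e) id-edge (boundaryStep-edge A) (λ _ → refl)
                                           (boundaryStep-involutive A)

    cut-on-e : ∀ {z} → edge G z ≡ e → cut z ≡ z
    cut-on-e z∈e = edgewise-in (λ i → eqB i e) id (boundaryStep G A) (≡⇒eqB z∈e)

    cut-off-e : ∀ {z} → edge G z ≢ e → cut z ≡ boundaryStep G A z
    cut-off-e z∉e = edgewise-out (λ i → eqB i e) id (boundaryStep G A) (≢⇒¬eqB z∉e)

    cutRel⊆componentRel : ∀ {y z} → T (cutRel y z) → T (componentRel A y z)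
    cutRel⊆componentRel = sameOrbit-⊆ _ (componentGens A) gens
      where
      gens : ∀ {g} → g ∈ (τ1 G ∷ cut ∷ []) → ∀ z → T (componentRel A z (g z))
      gens (here refl)         = sameOrbit-gen (here refl)
      gens (there (here refl)) z with on-or-off-e z
      ... | inj₁ z∈e = subst (T ∘ componentRel A z) (sym (cut-on-e z∈e)) (sameOrbit-refl _ z)
      ... | inj₂ z∉e = subst (T ∘ componentRel A z) (sym (cut-off-e z∉e)) (boundaryStep-component A z)

    -- If B agrees with A off e and its boundary pairs the flags of e as
    -- p₁ ↔ q₁ and p₂ ↔ q₂, the boundary components of (V(G), B) are the
    -- classes of cutRel with these two pairs fused.
    -- a boundary step sends q back to p when it sends p to q
    back : ∀ {B p q} → boundaryStep G B p ≡ q → boundaryStep G B q ≡ p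
    back {B} {p} refl = boundaryStep-involutive B p

    module BoundaryByFusion (B : EdgeSet G) (agree : ∀ {y} → edge G y ≢ e → B (edge G y) ≡ A (edge G y))
                            (p₁ q₁ p₂ q₂ : Flag) (cover : ∀ y → edge G y ≡ e → y ≡ p₁ ⊎ y ≡ q₁ ⊎ y ≡ p₂ ⊎ y ≡ q₂)
                            (step₁ : boundaryStep G B p₁ ≡ q₁) (step₂ : boundaryStep G B p₂ ≡ q₂) where
      inner fused : Rel
      inner = merge cutRel p₁ q₁
      fused = merge inner p₂ q₂

      inner-equivalence : Equivalence inner
      inner-equivalence = merge-equivalence cutRel-equivalence p₁ q₁

      lift : ∀ {y z} → T (inner y z) → T (fused y z)
      lift = merge-direct inner p₂ q₂

      off-e : ∀ {z} → edge G z ≢ e → boundaryStep G B z ≡ cut z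
      off-e {z} z∉e = trans (cong (λ β → if β then τ0 G z else τ2 G z) (agree z∉e)) (sym (cut-off-e z∉e))

      on-e : ∀ z → z ≡ p₁ ⊎ z ≡ q₁ ⊎ z ≡ p₂ ⊎ z ≡ q₂ → T (fused z (boundaryStep G B z))
      on-e z (inj₁ refl)               = subst (T ∘ fused p₁) (sym step₁) (lift (merge-fused cutRel-equivalence p₁ q₁))
      on-e z (inj₂ (inj₁ refl))        = subst (T ∘ fused q₁) (sym (back {B} step₁)) (lift (merge-fused′ cutRel-equivalence p₁ q₁))
      on-e z (inj₂ (inj₂ (inj₁ refl))) = subst (T ∘ fused p₂) (sym step₂) (merge-fused inner-equivalence p₂ q₂)
      on-e z (inj₂ (inj₂ (inj₂ refl))) = subst (T ∘ fused q₂) (sym (back {B} step₂)) (merge-fused′ inner-equivalence p₂ q₂)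

      boundary⊆fused : ∀ {y z} → T (boundaryRel B y z) → T (fused y z)
      boundary⊆fused = sameOrbit-least (boundaryGens B) fused refl′ trans′ gens
        where
        open Equivalence (merge-equivalence inner-equivalence p₂ q₂)
        gens : ∀ {g} → g ∈ boundaryGens B → ∀ z → T (fused z (g z))
        gens (here refl) z = lift (merge-direct cutRel p₁ q₁ (sameOrbit-gen (here refl) z))
        gens (there (here refl)) z with on-or-off-e z
        ... | inj₁ z∈e = on-e z (cover z z∈e)
        ... | inj₂ z∉e = lift (merge-direct cutRel p₁ q₁ (sameOrbit-gen≡ (there (here refl)) (sym (off-e z∉e))))

      cut⊆boundary : ∀ {y z} → T (cutRel y z) → T (boundaryRel B y z)
      cut⊆boundary = sameOrbit-⊆ _ (boundaryGens B) gens
        where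
        gens : ∀ {g} → g ∈ (τ1 G ∷ cut ∷ []) → ∀ z → T (boundaryRel B z (g z))
        gens (here refl) = sameOrbit-gen (here refl)
        gens (there (here refl)) z with on-or-off-e z
        ... | inj₁ z∈e = subst (T ∘ boundaryRel B z) (sym (cut-on-e z∈e)) (sameOrbit-refl _ z)
        ... | inj₂ z∉e = sameOrbit-gen≡ (there (here refl)) (off-e z∉e)

      fused⊆boundary : ∀ {y z} → T (fused y z) → T (boundaryRel B y z)
      fused⊆boundary = merge-least (boundaryRel-equivalence B)
                         (merge-least (boundaryRel-equivalence B) cut⊆boundary (sameOrbit-gen≡ (there (here refl)) step₁))
                         (sameOrbit-gen≡ (there (here refl)) step₂)

      fG-fused : fG G B ≡ classCount fused
      fG-fused = classCount-ext boundary⊆fused fused⊆boundary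

    fG-A : fG G A ≡ classCount (merge (merge cutRel a c) b d)
    fG-A = BoundaryByFusion.fG-fused A (λ _ → refl) a c b d flags-of-e′
             (edgewise-out A (τ0 G) (τ2 G) (not-in-A a∈e))
             (trans (edgewise-out A (τ0 G) (τ2 G) (not-in-A b∈e)) τ2b≡d)

    fG-A′ : fG G A′ ≡ classCount (merge (merge cutRel a b) c d)
    fG-A′ = BoundaryByFusion.fG-fused A′ A′-off-e a b c d flags-of-e
              (edgewise-in A′ (τ0 G) (τ2 G) (in-A′ a∈e))
              (edgewise-in A′ (τ0 G) (τ2 G) (in-A′ c∈e))

    fG-insert-≤ : fG G A′ ≤ suc (fG G A)
    fG-insert-≤ = subst₂ (λ x y → x ≤ suc y) (sym fG-A′) (sym fG-A) (classCount-reorder-≤ cutRel-equivalence a b c d)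

    onE : Flag → Bool
    onE y = eqB (edge G y) e

    -- Parity: every cutRel-class contains an even number of flags of e, since
    -- the class is closed under τ1 and its part off e under boundaryStep A,
    -- both fixed-point-free involutions.
    cutClass-even-on-e : ∀ p → 2 ∣ countB (nF G) (λ y → cutRel p y ∧ onE y)
    cutClass-even-on-e p = ∣m+n∣m⇒∣n (subst (2 ∣_) split even-class) even-off-e
      where
      open Equivalence cutRel-equivalence
      class offE : Flag → Bool
      class = cutRel p
      offE y = class y ∧ not (onE y)
      split : countB (nF G) class ≡ countB (nF G) offE + countB (nF G) (λ y → class y ∧ onE y)
      split = trans (countB-split (nF G) class onE) (ℕₚ.+-comm (countB (nF G) (λ y → class y ∧ onE y)) _)
      even-class : 2 ∣ countB (nF G) class
      even-class = countB-even (nF G) (τ1 G) (τ1-inv G) (τ1-fpf G) class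
                     (λ i h → trans′ h (sameOrbit-gen (here refl) i))
      even-off-e : 2 ∣ countB (nF G) offE
      even-off-e = countB-even (nF G) (boundaryStep G A) (boundaryStep-involutive A)
                     (edgewise-fpf A (τ0-fpf G) (τ2-fpf G)) offE closed
        where
        closed : ∀ i → T (offE i) → T (offE (boundaryStep G A i))
        closed i h = ∧-intro (trans′ (∧-fst h) (sameOrbit-gen≡ (there (here refl)) (cut-off-e i∉e)))
                             (not-intro (i∉e ∘ trans (sym (boundaryStep-edge A i)) ∘ eqB⇒≡))
          where
          i∉e : edge G i ≢ e
          i∉e i∈e = not-elim (∧-snd {class i} h) (≡⇒eqB i∈e)

    cut-parity : ∀ p p′ q q′ → edge G p ≡ e → (∀ y → edge G y ≡ e → y ≡ p ⊎ y ≡ p′ ⊎ y ≡ q ⊎ y ≡ q′) →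
      ¬ T (cutRel p q) → ¬ T (cutRel p q′) → T (cutRel p p′)
    cut-parity p p′ q q′ p∈e cover ¬pq ¬pq′ with T? (cutRel p p′)
    ... | yes pp′ = pp′
    ... | no ¬pp′ = ⊥-elim (2∤1 (subst (2 ∣_) onlyOne (cutClass-even-on-e p)))
      where
      2∤1 : ¬ (2 ∣ 1)
      2∤1 2∣1 with ∣1⇒≡1 2∣1
      ... | ()
      only-p : ∀ y → (cutRel p y ∧ onE y) ≡ eqB y p
      only-p y = T-ext to (λ y≡p → subst (λ w → T (cutRel p w ∧ onE w)) (sym (eqB⇒≡ y≡p))
                                          (∧-intro (Equivalence.refl′ cutRel-equivalence p) (≡⇒eqB p∈e)))
        where
        to : T (cutRel p y ∧ onE y) → T (eqB y p)
        to h with cover y (eqB⇒≡ (∧-snd {cutRel p y} h))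
        ... | inj₁ refl                = eqB-refl p
        ... | inj₂ (inj₁ refl)         = ⊥-elim (¬pp′ (∧-fst h))
        ... | inj₂ (inj₂ (inj₁ refl))  = ⊥-elim (¬pq (∧-fst h))
        ... | inj₂ (inj₂ (inj₂ refl))  = ⊥-elim (¬pq′ (∧-fst h))
      onlyOne : countB (nF G) (λ y → cutRel p y ∧ onE y) ≡ 1
      onlyOne = trans (countB-cong (nF G) only-p) (countB-single (nF G) p)

    cG-insert-within : T (componentRel A a b) → cG G A′ ≡ cG G A
    cG-insert-within ab = trans cG-insert (classCount-merge-related (componentRel-equivalence A) ab)

    insert-joining : ¬ T (componentRel A a b) → cG G A ≡ suc (cG G A′) × fG G A ≡ suc (fG G A′)
    insert-joining ¬ab = trans (classCount-merge-unrelated (componentRel-equivalence A) ¬ab) (cong suc (sym cG-insert))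
                       , trans fG-A (trans (classCount-reorder-≡ cutRel-equivalence a~cut~c b~cut~d ¬ab-cut)
                                           (cong suc (sym fG-A′)))
      where
      open Equivalence (componentRel-equivalence A)
      ¬ab-cut : ¬ T (cutRel a b)
      ¬ab-cut = ¬ab ∘ cutRel⊆componentRel
      a~cut~c : T (cutRel a c)
      a~cut~c = cut-parity a c b d a∈e flags-of-e′ ¬ab-cut
                  (λ ad → ¬ab (trans′ (cutRel⊆componentRel ad) (sym′ b~d)))
      b~cut~d : T (cutRel b d)
      b~cut~d = cut-parity b d a c b∈e flags-of-e″ (λ ba → ¬ab (sym′ (cutRel⊆componentRel ba)))
                  (λ bc → ¬ab (trans′ a~c (sym′ (cutRel⊆componentRel bc))))

  EulerInequalities : EdgeSet G → Set
  EulerInequalities A = EulerBounds v (cG G A) (card G A) (fG G A)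

  euler-cong : ∀ {A B} → A ≐ B → EulerInequalities A → EulerInequalities B
  euler-cong {A} {B} A≐B ineq
    rewrite sym (cG-cong A≐B) | sym (fG-cong A≐B) | sym (countB-cong (nE G) A≐B) = ineq

  euler-∅ : EulerInequalities ∅
  euler-∅ rewrite cG-∅ | fG-∅ | countB-none (nE G) {∅} (λ _ ()) =
    record { components≤vertices = ℕₚ.≤-refl
           ; vertices≤components+edges = ℕₚ.m≤m+n v 0
           ; genus-nonnegative = ℕₚ.≤-refl }

  euler-insert : ∀ A e → ¬ T (A e) → EulerInequalities A → EulerInequalities (insert A e)
  euler-insert A e e∉A ineq with edge-surj G e
  ... | a , a∈e with T? (componentRel A a (τ0 G a))
  ...   | yes ab = subst₂ (λ c m → EulerBounds v c m (fG G A′)) (sym (cG-insert-within ab)) (sym card-insert)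
                     (EulerArithmetic.bounds-within ineq fG-insert-≤)
    where
    open AddEdge A e e∉A a a∈e
  ...   | no ¬ab = subst (λ m → EulerBounds v (cG G A′) m (fG G A′)) (sym card-insert)
                     (EulerArithmetic.bounds-joining
                       (subst₂ (λ c f → EulerBounds v c (card G A) f) c≡1+c′ f≡1+f′ ineq))
    where
    open AddEdge A e e∉A a a∈e
    c≡1+c′ = proj₁ (insert-joining ¬ab)
    f≡1+f′ = proj₂ (insert-joining ¬ab)

  euler : ∀ A → EulerInequalities A
  euler = subset-induction EulerInequalities euler-cong euler-∅ euler-insert

-- With r = v - c and n = m - r, the Euler bounds make
-- all truncated differences in the A-th term of t·R_G(t+1, t, 1/t) honest,
-- and the powers of t and 1/t cancel down to t^f.
module Exponents where
  open import Data.Nat using (_+_)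

  exponents-balance : ∀ v c m f → 1 ≤ c → EulerBounds v c m f →
    suc ((v ∸ 1) ∸ (v ∸ c)) + (m ∸ (v ∸ c)) ≡ f + ((c + (m ∸ (v ∸ c))) ∸ f)
  exponents-balance v (suc p) m f _ bounds = begin
    suc ((v ∸ 1) ∸ r) + n  ≡⟨ cong (λ k → k + n) c-from-v ⟩
    c + n                  ≡⟨ sym (ℕₚ.m+[n∸m]≡n f≤c+n) ⟩
    f + ((c + n) ∸ f)      ∎
    where
    open ≡-Reasoning
    open EulerBounds bounds
    c = suc p
    r = v ∸ c
    n = m ∸ r
    v≡c+r : v ≡ c + r
    v≡c+r = sym (ℕₚ.m+[n∸m]≡n components≤vertices)
    r≤m : r ≤ m
    r≤m = ℕₚ.+-cancelˡ-≤ c r m (subst (_≤ c + m) v≡c+r vertices≤components+edges)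
    m≡r+n : m ≡ r + n
    m≡r+n = sym (ℕₚ.m+[n∸m]≡n r≤m)
    c-from-v : suc ((v ∸ 1) ∸ r) ≡ c
    c-from-v = cong suc (trans (cong (λ w → (w ∸ 1) ∸ r) v≡c+r) (ℕₚ.m+n∸n≡m p r))
    f≤c+n : f ≤ c + n
    f≤c+n = ℕₚ.+-cancelˡ-≤ (c + r) f (c + n)
              (subst₂ (λ x y → x + f ≤ y) v≡c+r (trans (cong (_+ (c + c)) m≡r+n) (regroup r n c)) genus-nonnegative)
      where
      open import Data.Nat.Solver using (module +-*-Solver)
      open +-*-Solver
      regroup : ∀ r n c → (r + n) + (c + c) ≡ (c + r) + (c + n)
      regroup = solve 3 (λ r n c → (r :+ n) :+ (c :+ c) := (c :+ r) :+ (c :+ n)) refl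

module Powers where
  open import Data.Rational using (ℚ; 1ℚ; _*_; 1/_; NonZero)
  open import Data.Rational.Properties using (*-assoc; *-comm; *-identityˡ; *-identityʳ; *-inverseʳ)
  open ≡-Reasoning

  ^-+ : ∀ t m k → t ^ (m ℕ.+ k) ≡ t ^ m * t ^ k
  ^-+ t zero    k = sym (*-identityˡ _)
  ^-+ t (suc m) k = trans (cong (t *_) (^-+ t m k)) (sym (*-assoc t (t ^ m) (t ^ k)))

  1^ : ∀ k → 1ℚ ^ k ≡ 1ℚ
  1^ zero    = refl
  1^ (suc k) = trans (*-identityˡ _) (1^ k)

  ^-*-distrib : ∀ s t k → (s * t) ^ k ≡ s ^ k * t ^ k
  ^-*-distrib s t zero    = refl
  ^-*-distrib s t (suc k) = begin
    (s * t) * (s * t) ^ k       ≡⟨ cong ((s * t) *_) (^-*-distrib s t k) ⟩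
    (s * t) * (s ^ k * t ^ k)   ≡⟨ *-assoc s t _ ⟩
    s * (t * (s ^ k * t ^ k))   ≡⟨ cong (s *_) (trans (sym (*-assoc t (s ^ k) (t ^ k)))
                                   (trans (cong (_* t ^ k) (*-comm t (s ^ k))) (*-assoc (s ^ k) t (t ^ k)))) ⟩
    s * (s ^ k * (t * t ^ k))   ≡⟨ sym (*-assoc s (s ^ k) _) ⟩
    (s * s ^ k) * (t * t ^ k)   ∎

  ^-cancel : ∀ t .{{_ : NonZero t}} f y → t ^ (f ℕ.+ y) * (1/ t) ^ y ≡ t ^ f
  ^-cancel t f y = begin
    t ^ (f ℕ.+ y) * (1/ t) ^ y       ≡⟨ cong (_* (1/ t) ^ y) (^-+ t f y) ⟩
    (t ^ f * t ^ y) * (1/ t) ^ y     ≡⟨ *-assoc (t ^ f) _ _ ⟩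
    t ^ f * (t ^ y * (1/ t) ^ y)     ≡⟨ cong (t ^ f *_) (sym (^-*-distrib t (1/ t) y)) ⟩
    t ^ f * (t * 1/ t) ^ y           ≡⟨ cong (λ s → t ^ f * s ^ y) (*-inverseʳ t) ⟩
    t ^ f * 1ℚ ^ y                   ≡⟨ cong (t ^ f *_) (1^ y) ⟩
    t ^ f * 1ℚ                       ≡⟨ *-identityʳ _ ⟩
    t ^ f                            ∎

  power-balance : ∀ t .{{_ : NonZero t}} α β γ f → suc α ℕ.+ β ≡ f ℕ.+ γ →
    t * ((t ^ α * t ^ β) * (1/ t) ^ γ) ≡ t ^ f
  power-balance t α β γ f balance = begin
    t * ((t ^ α * t ^ β) * (1/ t) ^ γ)  ≡⟨ sym (*-assoc t _ _) ⟩
    (t * (t ^ α * t ^ β)) * (1/ t) ^ γ  ≡⟨ cong (_* (1/ t) ^ γ) (sym (*-assoc t (t ^ α) (t ^ β))) ⟩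
    (t ^ suc α * t ^ β) * (1/ t) ^ γ    ≡⟨ cong (_* (1/ t) ^ γ) (sym (^-+ t (suc α) β)) ⟩
    t ^ (suc α ℕ.+ β) * (1/ t) ^ γ      ≡⟨ cong (λ k → t ^ k * (1/ t) ^ γ) balance ⟩
    t ^ (f ℕ.+ γ) * (1/ t) ^ γ          ≡⟨ ^-cancel t f γ ⟩
    t ^ f                               ∎

module FiniteSums where
  open BoolFacts
  open import Data.Nat using (_≡ᵇ_)
  import Data.Integer as ℤ
  import Data.Integer.Properties as ℤₚ
  open import Data.Rational using (ℚ; 0ℚ; 1ℚ; _+_; _*_; _/_)
  open import Data.Rational.Properties using (normalize-coprime; +-assoc; +-comm; +-identityˡ; +-identityʳ;
    *-identityˡ; *-zeroˡ; *-zeroʳ; *-distribˡ-+; *-distribʳ-+)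
  open import Data.Nat.Coprimality using (1-coprimeTo) renaming (sym to coprime-sym)
  open import Data.List using (List; []; _∷_; map; _++_; length; filter)
  open ≡-Reasoning

  sumℚ-cong : ∀ {X : Set} {F H : X → ℚ} (L : List X) → (∀ x → F x ≡ H x) → sumℚ (map F L) ≡ sumℚ (map H L)
  sumℚ-cong []      _   = refl
  sumℚ-cong (x ∷ L) F≗H = cong₂ _+_ (F≗H x) (sumℚ-cong L F≗H)

  *-sumℚ : ∀ {X : Set} t (F : X → ℚ) (L : List X) → t * sumℚ (map F L) ≡ sumℚ (map (λ x → t * F x) L)
  *-sumℚ t F []      = *-zeroʳ t
  *-sumℚ t F (x ∷ L) = trans (*-distribˡ-+ t (F x) _) (cong ((t * F x) +_) (*-sumℚ t F L))

  sumℚ-++ : ∀ {X : Set} (H : X → ℚ) xs ys → sumℚ (map H (xs ++ ys)) ≡ sumℚ (map H xs) + sumℚ (map H ys)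
  sumℚ-++ H []       ys = sym (+-identityˡ _)
  sumℚ-++ H (x ∷ xs) ys = trans (cong (H x +_) (sumℚ-++ H xs ys)) (sym (+-assoc (H x) _ _))

  sumℚ-zero : ∀ {X : Set} (L : List X) → sumℚ (map (λ _ → 0ℚ) L) ≡ 0ℚ
  sumℚ-zero []      = refl
  sumℚ-zero (x ∷ L) = trans (cong (0ℚ +_) (sumℚ-zero L)) (+-identityˡ 0ℚ)

  sumFrom-cong : ∀ a m {F H : ℕ → ℚ} → (∀ k → F k ≡ H k) → sumFrom a m F ≡ sumFrom a m H
  sumFrom-cong a zero    _   = refl
  sumFrom-cong a (suc m) F≗H = cong₂ _+_ (F≗H a) (sumFrom-cong (suc a) m F≗H)

  sumFrom-+ : ∀ a m (F H : ℕ → ℚ) → sumFrom a m (λ k → F k + H k) ≡ sumFrom a m F + sumFrom a m H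
  sumFrom-+ a zero    F H = sym (+-identityˡ 0ℚ)
  sumFrom-+ a (suc m) F H = trans (cong ((F a + H a) +_) (sumFrom-+ (suc a) m F H)) (interchange (F a) (H a) _ _)
    where
    interchange : ∀ a b c d → (a + b) + (c + d) ≡ (a + c) + (b + d)
    interchange a b c d = begin
      (a + b) + (c + d) ≡⟨ +-assoc a b (c + d) ⟩
      a + (b + (c + d)) ≡⟨ cong (a +_) (sym (+-assoc b c d)) ⟩
      a + ((b + c) + d) ≡⟨ cong (λ x → a + (x + d)) (+-comm b c) ⟩
      a + ((c + b) + d) ≡⟨ cong (a +_) (+-assoc c b d) ⟩
      a + (c + (b + d)) ≡⟨ sym (+-assoc a c (b + d)) ⟩
      (a + c) + (b + d) ∎

  sumFrom-zero : ∀ a m (F : ℕ → ℚ) → (∀ k → a ≤ k → F k ≡ 0ℚ) → sumFrom a m F ≡ 0ℚ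
  sumFrom-zero a zero    F _    = refl
  sumFrom-zero a (suc m) F vanish = trans (cong₂ _+_ (vanish a ℕₚ.≤-refl) (sumFrom-zero (suc a) m F (λ k a<k → vanish k (ℕₚ.<⇒≤ a<k))))
                                          (+-identityˡ 0ℚ)

  indℚ : Bool → ℚ
  indℚ b = if b then 1ℚ else 0ℚ

  sumFrom-single : ∀ (t : ℚ) c a m → a ≤ c → c < a ℕ.+ m → sumFrom a m (λ k → indℚ (c ≡ᵇ k) * t ^ k) ≡ t ^ c
  sumFrom-single t c a zero    a≤c c<a+0 = ⊥-elim (ℕₚ.<-irrefl refl (ℕₚ.≤-trans c<a+0 (subst (_≤ c) (sym (ℕₚ.+-identityʳ a)) a≤c)))
  sumFrom-single t c a (suc m) a≤c c<a+m with ℕₚ.m≤n⇒m<n∨m≡n a≤c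
  ... | inj₂ refl = trans (cong₂ _+_ (trans (cong (λ b → indℚ b * t ^ a) (T⇒≡true (ℕₚ.≡⇒≡ᵇ a a refl))) (*-identityˡ (t ^ a)))
                                     (sumFrom-zero (suc a) m _ later))
                          (+-identityʳ (t ^ a))
    where
    later : ∀ k → suc a ≤ k → indℚ (a ≡ᵇ k) * t ^ k ≡ 0ℚ
    later k a<k = trans (cong (λ b → indℚ b * t ^ k) (¬T⇒≡false (λ h → ℕₚ.<-irrefl (ℕₚ.≡ᵇ⇒≡ a k h) a<k))) (*-zeroˡ (t ^ k))
  ... | inj₁ a<c  = trans (cong₂ _+_ (trans (cong (λ b → indℚ b * t ^ a) (¬T⇒≡false (λ h → ℕₚ.<-irrefl (sym (ℕₚ.≡ᵇ⇒≡ c a h)) a<c)))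
                                            (*-zeroˡ (t ^ a)))
                                     (sumFrom-single t c (suc a) m a<c (subst (c <_) (ℕₚ.+-suc a m) c<a+m)))
                          (+-identityˡ (t ^ c))

  ℕtoℚ-suc : ∀ n → ℕtoℚ (suc n) ≡ 1ℚ + ℕtoℚ n
  ℕtoℚ-suc n rewrite normalize-coprime {n} {0} (coprime-sym (1-coprimeTo n)) =
    cong (_/ 1) (sym (cong (ℤ._+_ (ℤ.+ 1)) (ℤₚ.*-identityʳ (ℤ.+ n))))

  module _ {X : Set} (t : ℚ) (P : X → Bool) (weight : X → ℕ) where
    count : ℕ → List X → ℕ
    count k L = length (filter (λ s → T? (P s ∧ (weight s ≡ᵇ k))) L)

    count-∷ : ∀ k s L → ℕtoℚ (count k (s ∷ L)) ≡ indℚ (P s ∧ (weight s ≡ᵇ k)) + ℕtoℚ (count k L)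
    count-∷ k s L with P s ∧ (weight s ≡ᵇ k)
    ... | true  = ℕtoℚ-suc (count k L)
    ... | false = sym (+-identityˡ _)

    sumFrom-count : ∀ a m (L : List X) → (∀ s → T (P s) → a ≤ weight s × weight s < a ℕ.+ m) →
      sumFrom a m (λ k → ℕtoℚ (count k L) * t ^ k) ≡ sumℚ (map (λ s → if P s then t ^ weight s else 0ℚ) L)
    sumFrom-count a m []      _       = sumFrom-zero a m _ (λ k _ → *-zeroˡ (t ^ k))
    sumFrom-count a m (s ∷ L) inRange = begin
      sumFrom a m (λ k → ℕtoℚ (count k (s ∷ L)) * t ^ k)
        ≡⟨ sumFrom-cong a m (λ k → trans (cong (_* t ^ k) (count-∷ k s L)) (*-distribʳ-+ (t ^ k) (indℚ (P s ∧ (weight s ≡ᵇ k))) (ℕtoℚ (count k L)))) ⟩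
      sumFrom a m (λ k → indℚ (P s ∧ (weight s ≡ᵇ k)) * t ^ k + ℕtoℚ (count k L) * t ^ k)
        ≡⟨ sumFrom-+ a m _ _ ⟩
      sumFrom a m (λ k → indℚ (P s ∧ (weight s ≡ᵇ k)) * t ^ k) + sumFrom a m (λ k → ℕtoℚ (count k L) * t ^ k)
        ≡⟨ cong₂ _+_ (head (P s) refl) (sumFrom-count a m L inRange) ⟩
      (if P s then t ^ weight s else 0ℚ) + sumℚ (map (λ s → if P s then t ^ weight s else 0ℚ) L) ∎
      where
      head : ∀ b → P s ≡ b → sumFrom a m (λ k → indℚ (P s ∧ (weight s ≡ᵇ k)) * t ^ k) ≡ (if b then t ^ weight s else 0ℚ)
      head true  Ps = trans (sumFrom-cong a m (λ k → cong (λ w → indℚ (w ∧ (weight s ≡ᵇ k)) * t ^ k) Ps))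
                            (sumFrom-single t (weight s) a m (proj₁ range) (proj₂ range))
        where range = inRange s (≡true⇒T Ps)
      head false Ps = sumFrom-zero a m _ (λ k _ → trans (cong (λ w → indℚ (w ∧ (weight s ≡ᵇ k)) * t ^ k) Ps) (*-zeroˡ (t ^ k)))

module StateEnumeration where
  open FiniteCounting
  open FiniteSums
  open import Data.Rational using (ℚ; 0ℚ; _+_)
  open import Data.Rational.Properties using (+-comm; +-identityˡ; +-identityʳ)
  open import Data.List using (List; []; _∷_; map; _++_; foldr)
  open ≡-Reasoning

  cons : ∀ {X : Set} {n} → X → (Fin n → X) → Fin (suc n) → X
  cons a f Fin.zero    = a
  cons a f (Fin.suc i) = f i

  Extensional : ∀ {X : Set} {n} → ((Fin n → X) → ℚ) → Set
  Extensional {X} {n} H = ∀ {f g : Fin n → X} → (∀ i → f i ≡ g i) → H f ≡ H g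

  sumℚ-allFunctions-suc : ∀ {X : Set} (vs : List X) n (H : (Fin (suc n) → X) → ℚ) → Extensional H →
    sumℚ (map H (allFunctions vs (suc n))) ≡ sumℚ (map (λ a → sumℚ (map (λ f → H (cons a f)) (allFunctions vs n))) vs)
  sumℚ-allFunctions-suc {X} vs n H ext = blocks _ (λ a f → λ { Fin.zero → refl ; (Fin.suc i) → refl }) vs
    where
    L = allFunctions vs n
    blocks : (g : X → (Fin n → X) → Fin (suc n) → X) → (∀ a f i → g a f i ≡ cons a f i) → ∀ ws →
      sumℚ (map H (foldr (λ a acc → map (λ f → g a f) L ++ acc) [] ws))
        ≡ sumℚ (map (λ a → sumℚ (map (λ f → H (cons a f)) L)) ws)
    blocks g g≗cons []       = refl
    blocks g g≗cons (a ∷ ws) = trans (sumℚ-++ H (map (g a) L) _)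
                                     (cong₂ _+_ (block L) (blocks g g≗cons ws))
      where
      block : ∀ L → sumℚ (map H (map (g a) L)) ≡ sumℚ (map (λ f → H (cons a f)) L)
      block []      = refl
      block (f ∷ L) = cong₂ _+_ (ext (g≗cons a f)) (block L)

  -- the non-crossing state following the edges of A and crossing the others
  smoothing : ∀ {n} → (Fin n → Bool) → Fin n → VertexState
  smoothing A i = if A i then smoothing0 else smoothing2

  hasNoCrossing : ∀ {n} → (Fin n → VertexState) → Bool
  hasNoCrossing {n} s = allFinB n (λ e → not (isCrossing (s e)))

  sum-noncrossing : ∀ n (F : (Fin n → VertexState) → ℚ) → Extensional F →
    sumℚ (map (λ s → if hasNoCrossing s then F s else 0ℚ) (allFunctions (crossing ∷ smoothing0 ∷ smoothing2 ∷ []) n))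
      ≡ sumℚ (map (λ A → F (smoothing A)) (allSubsets n))
  sum-noncrossing zero    F ext = cong (_+ 0ℚ) (ext (λ ()))
  sum-noncrossing (suc n) F ext = begin
    sumℚ (map guarded (allFunctions states (suc n)))
      ≡⟨ sumℚ-allFunctions-suc states n guarded guarded-ext ⟩
    sumℚ (map (λ f → 0ℚ) (allFunctions states n)) + (X₀ + (X₂ + 0ℚ))
      ≡⟨ cong₂ _+_ (sumℚ-zero (allFunctions states n))
           (cong₂ _+_ (sum-noncrossing n (λ f → F (cons smoothing0 f)) (λ f≗g → ext (cons-ext f≗g)))
                      (cong (_+ 0ℚ) (sum-noncrossing n (λ f → F (cons smoothing2 f)) (λ f≗g → ext (cons-ext f≗g))))) ⟩
    0ℚ + (Y₀ + (Y₂ + 0ℚ))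
      ≡⟨ trans (+-identityˡ _) (trans (cong (Y₀ +_) (+-identityʳ Y₂)) (trans (+-comm Y₀ Y₂) (cong (Y₂ +_) (sym (+-identityʳ Y₀))))) ⟩
    Y₂ + (Y₀ + 0ℚ)
      ≡⟨ sym (trans (sumℚ-allFunctions-suc (false ∷ true ∷ []) n (λ A → F (smoothing A)) (λ A≗B → ext (smoothing-ext A≗B)))
                    (cong₂ _+_ (sumℚ-cong (allSubsets n) (λ A → ext (smoothing-cons false A)))
                               (cong (_+ 0ℚ) (sumℚ-cong (allSubsets n) (λ A → ext (smoothing-cons true A)))))) ⟩
    sumℚ (map (λ A → F (smoothing A)) (allSubsets (suc n)))
      ∎
    where
    states : List VertexState
    states = crossing ∷ smoothing0 ∷ smoothing2 ∷ []
    guarded : (Fin (suc n) → VertexState) → ℚ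
    guarded s = if hasNoCrossing s then F s else 0ℚ
    guarded-ext : Extensional guarded
    guarded-ext s≗s′ = cong₂ (λ b x → if b then x else 0ℚ)
                         (allFinB-cong (suc n) (λ i → cong (λ w → not (isCrossing w)) (s≗s′ i))) (ext s≗s′)
    cons-ext : ∀ {a} {f g : Fin n → VertexState} → (∀ i → f i ≡ g i) → ∀ i → cons a f i ≡ cons a g i
    cons-ext f≗g Fin.zero    = refl
    cons-ext f≗g (Fin.suc i) = f≗g i
    smoothing-ext : ∀ {A B : Fin (suc n) → Bool} → (∀ i → A i ≡ B i) → ∀ i → smoothing A i ≡ smoothing B i
    smoothing-ext A≗B i = cong (λ b → if b then smoothing0 else smoothing2) (A≗B i)
    smoothing-cons : ∀ b (A : Fin n → Bool) i →
      smoothing (cons b A) i ≡ cons (if b then smoothing0 else smoothing2) (smoothing A) i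
    smoothing-cons b A Fin.zero    = refl
    smoothing-cons b A (Fin.suc i) = refl
    X₀ X₂ Y₀ Y₂ : ℚ
    X₀ = sumℚ (map (λ f → if hasNoCrossing f then F (cons smoothing0 f) else 0ℚ) (allFunctions states n))
    X₂ = sumℚ (map (λ f → if hasNoCrossing f then F (cons smoothing2 f) else 0ℚ) (allFunctions states n))
    Y₀ = sumℚ (map (λ A → F (cons smoothing0 (smoothing A))) (allSubsets n))
    Y₂ = sumℚ (map (λ A → F (cons smoothing2 (smoothing A))) (allSubsets n))

-- The non-crossing state attached to an edge set A follows the boundary of
-- (V(G), A), so its components are the boundary components: f_G(A).
module GraphStates (G : EmbeddedGraph) where
  open FiniteCounting
  open Orbits {nF G}
  open ClassCounting {nF G}
  open RibbonSubgraphs G using (Flag; Involutive; EdgePreserving; τ0-edge; τ2-edge)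
  open StateEnumeration using (smoothing)
  open import Data.List using ([]; _∷_)
  open import Data.List.Relation.Unary.All using ([]; _∷_)

  pairing : VertexState → Flag → Flag
  pairing crossing   z = τ0 G (τ2 G z)
  pairing smoothing0 z = τ0 G z
  pairing smoothing2 z = τ2 G z

  statePairing-pairing : ∀ (s : GraphState G) z → statePairing G s z ≡ pairing (s (edge G z)) z
  statePairing-pairing s z with s (edge G z)
  ... | crossing   = refl
  ... | smoothing0 = refl
  ... | smoothing2 = refl

  pairing-edge : ∀ w → EdgePreserving (pairing w)
  pairing-edge crossing   z = trans (τ0-edge (τ2 G z)) (τ2-edge z)
  pairing-edge smoothing0   = τ0-edge
  pairing-edge smoothing2   = τ2-edge

  pairing-involutive : ∀ w → Involutive (pairing w)
  pairing-involutive crossing   z = begin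
    τ0 G (τ2 G (τ0 G (τ2 G z))) ≡⟨ cong (τ0 G) (sym (τ02-comm G (τ2 G z))) ⟩
    τ0 G (τ0 G (τ2 G (τ2 G z))) ≡⟨ τ0-inv G _ ⟩
    τ2 G (τ2 G z)               ≡⟨ τ2-inv G z ⟩
    z                           ∎
    where open ≡-Reasoning
  pairing-involutive smoothing0 = τ0-inv G
  pairing-involutive smoothing2 = τ2-inv G

  statePairing-involutive : ∀ s → Involutive (statePairing G s)
  statePairing-involutive s z = begin
    statePairing G s (statePairing G s z)        ≡⟨ statePairing-pairing s _ ⟩
    pairing (s (edge G (statePairing G s z))) (statePairing G s z)
                                                 ≡⟨ cong₂ (λ w y → pairing (s w) y) sameEdge (statePairing-pairing s z) ⟩
    pairing (s (edge G z)) (pairing (s (edge G z)) z) ≡⟨ pairing-involutive (s (edge G z)) z ⟩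
    z                                            ∎
    where
    open ≡-Reasoning
    sameEdge : edge G (statePairing G s z) ≡ edge G z
    sameEdge = trans (cong (edge G) (statePairing-pairing s z)) (pairing-edge (s (edge G z)) z)

  stateComponents-cong : ∀ {s s′ : GraphState G} → (∀ i → s i ≡ s′ i) → stateComponents G s ≡ stateComponents G s′
  stateComponents-cong {s} {s′} s≗s′ = classCount-cong (sameOrbit-pointwise
    ((λ _ → refl) ∷ (λ z → trans (statePairing-pairing s z)
                           (trans (cong (λ w → pairing w z) (s≗s′ (edge G z))) (sym (statePairing-pairing s′ z)))) ∷ []))

  stateComponents-range : ∀ (s : GraphState G) → Flag → 1 ≤ stateComponents G s × stateComponents G s < 1 ℕ.+ nF G
  stateComponents-range s z =
    classCount-pos (sameOrbit-equivalence _ (τ1-inv G ∷ statePairing-involutive s ∷ [])) z ,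
    s≤s (countB-≤ (nF G) _)

  stateComponents-smoothing : ∀ A → stateComponents G (smoothing A) ≡ fG G A
  stateComponents-smoothing A = classCount-cong (sameOrbit-pointwise
    ((λ _ → refl) ∷ (λ z → trans (statePairing-pairing (smoothing A) z) (follows (A (edge G z)))) ∷ []))
    where
    follows : ∀ {z} b → pairing (if b then smoothing0 else smoothing2) z ≡ (if b then τ0 G z else τ2 G z)
    follows true  = refl
    follows false = refl

open import Data.Rational using (ℚ; NonZero; 1ℚ; _+_; _*_; 1/_)

module Evaluation (G : EmbeddedGraph) (connected : Connected G) (z : Fin (nF G)) (t : ℚ) .{{_ : NonZero t}} where
  open import Data.Rational using (0ℚ; _-_; -_)
  open import Data.Rational.Properties using (+-assoc; +-inverseʳ; +-identityʳ)
  open import Data.List using (map)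
  open ClassCounting {nF G} using (classCount-pos)
  open RibbonSubgraphs G using (v; cG-full; componentRel-equivalence; euler)
  open GraphStates G using (stateComponents-cong; stateComponents-range; stateComponents-smoothing)
  open StateEnumeration using (sum-noncrossing)
  open FiniteSums using (sumℚ-cong; *-sumℚ; sumFrom-count)
  open Exponents using (exponents-balance)
  open Powers using (power-balance)
  open ≡-Reasoning

  -- t times the A-th term of R_G(t+1, t, 1/t) is t^{f(A)}, since r(E) = v - 1
  term-value : ∀ A →
    t * ((((t + 1ℚ) - 1ℚ) ^ (rG G (fullSet G) ∸ rG G A)) * (t ^ nG G A) * ((1/ t) ^ ((cG G A ℕ.+ nG G A) ∸ fG G A)))
      ≡ t ^ fG G A
  term-value A = begin
    t * ((((t + 1ℚ) - 1ℚ) ^ ((v ∸ cG G (fullSet G)) ∸ (v ∸ c)) * t ^ n) * (1/ t) ^ ((c ℕ.+ n) ∸ f))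
      ≡⟨ cong₂ (λ x k → t * ((x ^ ((v ∸ k) ∸ (v ∸ c)) * t ^ n) * (1/ t) ^ ((c ℕ.+ n) ∸ f)))
               t+1-1≡t (cG-full connected z) ⟩
    t * ((t ^ ((v ∸ 1) ∸ (v ∸ c)) * t ^ n) * (1/ t) ^ ((c ℕ.+ n) ∸ f))
      ≡⟨ power-balance t ((v ∸ 1) ∸ (v ∸ c)) n ((c ℕ.+ n) ∸ f) f (exponents-balance v c (card G A) f
           (classCount-pos (componentRel-equivalence A) z) (euler A)) ⟩
    t ^ f ∎
    where
    c = cG G A
    f = fG G A
    n = nG G A
    t+1-1≡t : (t + 1ℚ) - 1ℚ ≡ t
    t+1-1≡t = trans (+-assoc t 1ℚ (- 1ℚ)) (trans (cong (t +_) (+-inverseʳ 1ℚ)) (+-identityʳ t))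

  BR-evaluation : t * BR G (t + 1ℚ) t (1/ t) ≡ sumℚ (map (λ A → t ^ fG G A) (allSubsets (nE G)))
  BR-evaluation = trans (*-sumℚ t _ (allSubsets (nE G))) (sumℚ-cong (allSubsets (nE G)) term-value)

  state-polynomial : sumFrom 1 (nF G) (λ k → ℕtoℚ (fk G k) * (t ^ k)) ≡ sumℚ (map (λ A → t ^ fG G A) (allSubsets (nE G)))
  state-polynomial = begin
    sumFrom 1 (nF G) (λ k → ℕtoℚ (fk G k) * (t ^ k))
      ≡⟨ sumFrom-count t (noCrossings G) (stateComponents G) 1 (nF G) (allGraphStates G)
                       (λ s _ → stateComponents-range s z) ⟩
    sumℚ (map (λ s → if noCrossings G s then t ^ stateComponents G s else 0ℚ) (allGraphStates G))
      ≡⟨ sum-noncrossing (nE G) (λ s → t ^ stateComponents G s) (λ s≗s′ → cong (t ^_) (stateComponents-cong s≗s′)) ⟩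
    sumℚ (map (λ A → t ^ stateComponents G (StateEnumeration.smoothing A)) (allSubsets (nE G)))
      ≡⟨ sumℚ-cong (allSubsets (nE G)) (λ A → cong (t ^_) (stateComponents-smoothing A)) ⟩
    sumℚ (map (λ A → t ^ fG G A) (allSubsets (nE G))) ∎

proposition6p9 : (G : EmbeddedGraph) → Connected G → 1 ≤ nE G →
    (t : ℚ) → .{{_ : NonZero t}} →
    t * BR G (t + 1ℚ) t (1/ t) ≡ sumFrom 1 (nF G) (λ k → ℕtoℚ (fk G k) * (t ^ k))
proposition6p9 G connected hasEdge t = trans BR-evaluation (sym state-polynomial)
  where
  z : Fin (nF G)
  z = proj₁ (edge-surj G (Fin.fromℕ< hasEdge))
  open Evaluation G connected z t
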